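{- Let $G$ be a connected graph of order $n$ with $m$ edges, maximum degree $\Delta$ and minimum degree $\delta$, such that its complement $\overline{G}$ is also connected, and let $k$ be an integer with $2\leq k\leq n$. Let $s_1=\max\{\Delta,\,n-\delta-1\}$ and $t_1=\min\{\delta,\,n-\Delta-1\}$. Then: (1) $\operatorname{SGut}_k(G)+\operatorname{SGut}_k(\overline{G})\leq (n-1)^2\binom{n}{k}s_1^{k-1}$ and $\operatorname{SGut}_k(G)\cdot \operatorname{SGut}_k(\overline{G})\leq 2m(n^2-n-2m)(n-1)^2\binom{n-1}{k-1}^2\frac{\Delta^{k-1}(n-\delta-1)^{k-1}}{k^2}$; moreover, these upper bounds are sharp. (2) $$\operatorname{SGut}_k(G)+\operatorname{SGut}_k(\overline{G})\geq\begin{cases}(n-1)(k-1)\binom{n}{k}t_1^{k-1} & \text{if } \delta\geq 2,\ \Delta\leq n-3,\\ 2m(k-1)\binom{n-1}{k-1}\frac{\delta^{k-1}}{k}+k\binom{n}{k} & \text{if } \delta\geq 2,\ \Delta=n-2,\\ k\binom{n}{k}+[n(n-1)-2m](k-1)\binom{n-1}{k-1}\frac{(n-\Delta-1)^{k-1}}{k} & \text{if } \delta=1,\ \Delta\leq n-3,\\ 2k\binom{n}{k} & \text{if } \delta=1,\ \Delta=n-2.\end{cases}$$ (3) $$\operatorname{SGut}_k(G)\cdot\operatorname{SGut}_k(\overline{G})\geq\begin{cases}2m(n^2-n-2m)(k-1)^2\binom{n-1}{k-1}^2\frac{\delta^{k-1}(n-\Delta-1)^{k-1}}{k^2} & \text{if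 } \delta\geq 2,\ \Delta\leq n-3,\\ 2m(k-1)\binom{n}{k}\binom{n-1}{k-1}\delta^{k-1} & \text{if } \delta\geq 2,\ \Delta=n-2,\\ [n(n-1)-2m](k-1)\binom{n}{k}\binom{n-1}{k-1}(n-\Delta-1)^{k-1} & \text{if } \delta=1,\ \Delta\leq n-3,\\ k^2\binom{n}{k}^2 & \text{if } \delta=1,\ \Delta=n-2.\end{cases}$$
   Context: All graphs are finite, simple and undirected; $\overline{G}$ is the complement of $G$. For a connected graph $G$ and $S\subseteq V(G)$ with $|S|\ge 2$, the Steiner distance $d_G(S)$ is the minimum number of edges of a connected subgraph of $G$ whose vertex set contains $S$. $\deg_G(v)$ is the degree of $v$. The Steiner Gutman $k$-index is $\operatorname{SGut}_k(G)=\sum_{S\subseteq V(G),\,|S|=k}\left(\prod_{v\in S}\deg_G(v)\right)d_G(S)$. "Sharp" means that equality is attained for some graph $G$ satisfying the hypotheses. -}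

module Defs where

open import Data.Nat using (ℕ; zero; suc; _+_; _*_; _<_; _≤_; _<ᵇ_; _≡ᵇ_)
open import Data.Bool using (Bool; true; false; not; _∧_; if_then_else_)
open import Data.Fin using (Fin; toℕ)
open import Data.Fin.Properties using (_≟_)
open import Data.Fin.Subset using (Subset; _∈_; _⊆_; ∣_∣; inside; outside)
open import Data.Vec using (Vec; []; _∷_; lookup)
open import Data.List using (List; []; _∷_; _++_; map; allFin)
open import Data.Nat.ListAction using (sum; product)
open import Data.Product using (Σ; Σ-syntax; _×_; _,_)
open import Relation.Binary.PropositionalEquality using (_≡_; refl; cong; sym)
open import Relation.Nullary using (yes; no)
open import Relation.Nullary.Decidable using (⌊_⌋)

record Graph (n : ℕ) : Set where
  field
    adj    : Fin n → Fin n → Bool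
    adj-sym    : ∀ u v → adj u v ≡ adj v u
    adj-irrefl : ∀ v → adj v v ≡ false
open Graph public

private
  eqb : ∀ {n} → Fin n → Fin n → Bool
  eqb u v = ⌊ u ≟ v ⌋

  eqb-sym : ∀ {n} (u v : Fin n) → eqb u v ≡ eqb v u
  eqb-sym u v with u ≟ v | v ≟ u
  ... | yes _ | yes _ = refl
  ... | no _  | no _  = refl
  ... | yes p | no q  with q (sym p)
  ... | ()
  eqb-sym u v | no p | yes q with p (sym q)
  ... | ()

  eqb-refl : ∀ {n} (v : Fin n) → eqb v v ≡ true
  eqb-refl v with v ≟ v
  ... | yes _ = refl
  ... | no p with p refl
  ... | ()

  ∧-false : ∀ b → b ∧ false ≡ false
  ∧-false true  = refl
  ∧-false false = refl

complement : ∀ {n} → Graph n → Graph n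
complement {n} G = record
  { adj        = λ u v → not (adj G u v) ∧ not (eqb u v)
  ; adj-sym    = λ u v → cong₂' (adj-sym G u v) (eqb-sym u v)
  ; adj-irrefl = λ v → irr v
  }
  where
  cong₂' : ∀ {a b c d : Bool} → a ≡ b → c ≡ d → not a ∧ not c ≡ not b ∧ not d
  cong₂' refl refl = refl
  irr : ∀ v → not (adj G v v) ∧ not (eqb v v) ≡ false
  irr v rewrite eqb-refl v = ∧-false (not (adj G v v))

edgeCount : ∀ {n} → (Fin n → Fin n → Bool) → ℕ
edgeCount {n} E =
  sum (map (λ u → sum (map (λ v → if (toℕ u <ᵇ toℕ v) ∧ E u v then 1 else 0)
                           (allFin n)))
           (allFin n))

size : ∀ {n} → Graph n → ℕ
size G = edgeCount (adj G)

deg : ∀ {n} → Graph n → Fin n → ℕ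
deg {n} G v = sum (map (λ u → if adj G v u then 1 else 0) (allFin n))

IsMaxDegree : ∀ {n} → Graph n → ℕ → Set
IsMaxDegree G Δ = (∀ v → deg G v ≤ Δ) × Σ[ v ∈ _ ] deg G v ≡ Δ

IsMinDegree : ∀ {n} → Graph n → ℕ → Set
IsMinDegree G δ = (∀ v → δ ≤ deg G v) × Σ[ v ∈ _ ] deg G v ≡ δ

data Reach {n : ℕ} (E : Fin n → Fin n → Bool) : Fin n → Fin n → Set where
  here : ∀ {u} → Reach E u u
  step : ∀ {u w v} → E u w ≡ true → Reach E w v → Reach E u v

Connected : ∀ {n} → Graph n → Set
Connected {n} G = ∀ (u v : Fin n) → Reach (adj G) u v

record ConnSubgraphContaining {n : ℕ} (G : Graph n) (S : Subset n) : Set where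
  field
    W       : Subset n
    F       : Fin n → Fin n → Bool
    F-sym   : ∀ u v → F u v ≡ F v u
    F⊆E     : ∀ u v → F u v ≡ true → adj G u v ≡ true
    F-ends  : ∀ u v → F u v ≡ true → (u ∈ W) × (v ∈ W)
    S⊆W     : S ⊆ W
    W-conn  : ∀ u v → u ∈ W → v ∈ W → Reach F u v
open ConnSubgraphContaining public

edgesOf : ∀ {n} {G : Graph n} {S : Subset n} → ConnSubgraphContaining G S → ℕ
edgesOf H = edgeCount (F H)

SteinerDist : ∀ {n} → Graph n → Subset n → ℕ → Set
SteinerDist G S d =
  (Σ[ H ∈ ConnSubgraphContaining G S ] edgesOf H ≡ d) ×
  (∀ (H : ConnSubgraphContaining G S) → d ≤ edgesOf H)

allSubsets : ∀ n → List (Subset n)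
allSubsets zero    = [] ∷ []
allSubsets (suc n) = map (inside ∷_) (allSubsets n) ++ map (outside ∷_) (allSubsets n)

degProd : ∀ {n} → Graph n → Subset n → ℕ
degProd {n} G S = product (map (λ v → if lookup S v then deg G v else 1) (allFin n))

IsSGut : ∀ {n} → Graph n → ℕ → ℕ → Set
IsSGut {n} G k x =
  Σ[ dist ∈ (Subset n → ℕ) ]
    ((∀ S → ∣ S ∣ ≡ k → SteinerDist G S (dist S)) ×
     (x ≡ sum (map (λ S → if ∣ S ∣ ≡ᵇ k then degProd G S * dist S else 0)
                   (allSubsets n))))

Hyp : ∀ n → Graph n → (k m Δ δ : ℕ) → Set
Hyp n G k m Δ δ =
  Connected G × Connected (complement G) × size G ≡ m ×
  IsMaxDegree G Δ × IsMinDegree G δ × 2 ≤ k × k ≤ n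

module Submission where

-- A breadth-first spanning tree of a connected subgraph on a vertex set W has |W| − 1 edges, so
-- k − 1 ≤ d(S) ≤ n − 1 for every k-subset S. If all degrees lie between μ and M, then
-- k · ∏_{v∈S} deg v lies between μ^(k−1) · Σ_{v∈S} deg v and M^(k−1) · Σ_{v∈S} deg v. Summed over
-- all k-subsets, every vertex is counted C(n−1, k−1) times, so the degree sums become
-- C(n−1, k−1) · 2m for G and C(n−1, k−1) · (n(n−1) − 2m) for its complement, whose degrees lie
-- between n − 1 − Δ and n − 1 − δ. The remaining lower bound k · C(n, k) ≤ SGut_k holds termwise:
-- if S contains a vertex of degree at least 2 then ∏ deg ≥ 2 and d(S) ≥ k − 1 ≥ k/2; if S consists
-- of leaves, a Steiner tree of S with fewer than k edges would have no vertex outside S and so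
-- would contain an edge joining two leaves, impossible in a connected graph with n ≥ 3.
-- The self-complementary 2-regular 5-cycle attains both upper bounds for k = n = 5.

open import Defs

open import Data.Bool using (Bool; true; false; not; _∧_; _∨_; if_then_else_; T)
open import Data.Bool.Properties using (∨-zeroʳ; ∨-comm; ∧-identityʳ)
import Data.Bool.Properties as Bool
open import Data.Empty using (⊥-elim)
open import Data.Fin using (Fin; zero; suc; toℕ; fromℕ<)
open import Data.Fin.Properties using (_≟_; toℕ-injective; any?; all?; injective⇒≤)
import Data.Fin.Properties as Fin
open import Data.Fin.Subset using (Subset; inside; outside; ∣_∣; _∈_; ⊤)
open import Data.Fin.Subset.Properties
  using (_∈?_; nonempty?; Empty-unique; ∣⊥∣≡0; ∈⊤; p⊆q⇒∣p∣≤∣q∣; p⊂q⇒∣p∣<∣q∣)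
open import Data.List using (List; []; _∷_; _++_; map; allFin; tabulate)
open import Data.List.Properties using (map-tabulate; map-++; map-∘)
open import Data.Nat
  using (ℕ; zero; suc; _+_; _*_; _∸_; _^_; _≤_; _<_; _⊔_; _⊓_; _<ᵇ_; _≡ᵇ_; z≤n; s≤s; >-nonZero)
open import Data.Nat.Combinatorics using (_C_; nCk+nC[k+1]≡[n+1]C[k+1])
open import Data.Nat.DivMod using (m%n<n)
import Data.Nat.ListAction as List
open import Data.Nat.ListAction.Properties using (sum-++)
open import Data.Nat.Properties hiding (_≟_)
import Data.Nat.Properties as ℕ
open import Algebra.Properties.CommutativeSemigroup +-commutativeSemigroup
  using () renaming (interchange to +-interchange)
open import Algebra.Properties.CommutativeSemigroup *-commutativeSemigroup
  using (x∙yz≈y∙xz; x∙yz≈z∙xy) renaming (interchange to *-interchange)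
open import Algebra.Properties.Semiring.Sum +-*-semiring using (sum; sum-cong-≗; ∑-distrib-+; ∑-comm)
open import Data.Nat.Tactic.RingSolver using (solve-∀)
open import Data.Product using (Σ-syntax; ∃; _×_; _,_; proj₁; proj₂)
open import Data.Sum using (_⊎_; inj₁; inj₂)
open import Data.Unit using (tt)
open import Data.Vec using ([]; _∷_; lookup; here; there)
open import Data.Vec.Properties using ([]=⇒lookup; lookup⇒[]=)
open import Function using (_∘_; case_of_)
open import Relation.Binary.PropositionalEquality
open import Relation.Nullary using (Dec; yes; no; ¬?; _×-dec_)
open import Relation.Nullary.Decidable using (⌊_⌋; ⌊⌋-map′; from-yes)

𝟙 : Bool → ℕ
𝟙 b = if b then 1 else 0

≟-refl : ∀ {n} (v : Fin n) → ⌊ v ≟ v ⌋ ≡ true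
≟-refl v with v ≟ v
... | yes _   = refl
... | no v≢v = ⊥-elim (v≢v refl)

≟-false : ∀ {n} {u v : Fin n} → u ≢ v → ⌊ u ≟ v ⌋ ≡ false
≟-false {u = u} {v} u≢v with u ≟ v
... | yes u≡v = ⊥-elim (u≢v u≡v)
... | no _    = refl

≟-not : ∀ {n} {u v : Fin n} → not ⌊ u ≟ v ⌋ ≡ true → u ≢ v
≟-not {u = u} {v} h with u ≟ v
... | no u≢v = u≢v

≟-true : ∀ {n} {u v : Fin n} → ⌊ u ≟ v ⌋ ≡ true → u ≡ v
≟-true {u = u} {v} eq with u ≟ v
... | yes u≡v = u≡v

∧-true : ∀ {a b} → a ∧ b ≡ true → a ≡ true × b ≡ true
∧-true {true} {true} _ = refl , refl

𝟙-mono : ∀ {a b} → (a ≡ true → b ≡ true) → 𝟙 a ≤ 𝟙 b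
𝟙-mono {false} _   = z≤n
𝟙-mono {true}  a⇒b rewrite a⇒b refl = ≤-refl

count : ∀ {n} → (Fin n → Bool) → ℕ
count P = sum (λ v → 𝟙 (P v))

sum-tabulate : ∀ {n} (f : Fin n → ℕ) → List.sum (tabulate f) ≡ sum f
sum-tabulate {zero}  f = refl
sum-tabulate {suc n} f = cong (f zero +_) (sum-tabulate (f ∘ suc))

sum-allFin : ∀ {n} (f : Fin n → ℕ) → List.sum (map f (allFin n)) ≡ sum f
sum-allFin f = trans (cong List.sum (map-tabulate (λ v → v) f)) (sum-tabulate f)

sum-mono-≤ : ∀ {n} {f g : Fin n → ℕ} → (∀ v → f v ≤ g v) → sum f ≤ sum g
sum-mono-≤ {zero}  f≤g = z≤n
sum-mono-≤ {suc n} f≤g = +-mono-≤ (f≤g zero) (sum-mono-≤ (f≤g ∘ suc))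

sum-const : ∀ n c → sum {n} (λ _ → c) ≡ n * c
sum-const zero    c = refl
sum-const (suc n) c = cong (c +_) (sum-const n c)

count-false : ∀ {n} → count {n} (λ _ → false) ≡ 0
count-false {n} = trans (sum-const n 0) (*-zeroʳ n)

count-≟ : ∀ {n} (v : Fin n) → count (λ u → ⌊ v ≟ u ⌋) ≡ 1
count-≟ {suc n} zero    = cong suc (count-false {n})
count-≟ {suc n} (suc v) =
  trans (sum-cong-≗ (λ u → cong 𝟙 (⌊⌋-map′ (cong suc) Fin.suc-injective (v ≟ u)))) (count-≟ v)

count-remove : ∀ {n} (P : Fin n → Bool) {r} → P r ≡ true →
               count P ≡ suc (count (λ v → P v ∧ not ⌊ r ≟ v ⌋))
count-remove {n} P {r} Pr = begin
  count P                                             ≡⟨ sum-cong-≗ split ⟩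
  sum (λ v → 𝟙 (P v ∧ not ⌊ r ≟ v ⌋) + 𝟙 ⌊ r ≟ v ⌋)
    ≡⟨ ∑-distrib-+ (λ v → 𝟙 (P v ∧ not ⌊ r ≟ v ⌋)) (λ v → 𝟙 ⌊ r ≟ v ⌋) ⟩
  X + count (λ v → ⌊ r ≟ v ⌋)                         ≡⟨ cong (X +_) (count-≟ r) ⟩
  X + 1                                               ≡⟨ +-comm X 1 ⟩
  suc X                                               ∎
  where
  open ≡-Reasoning
  X : ℕ
  X = count (λ v → P v ∧ not ⌊ r ≟ v ⌋)
  split : ∀ v → 𝟙 (P v) ≡ 𝟙 (P v ∧ not ⌊ r ≟ v ⌋) + 𝟙 ⌊ r ≟ v ⌋
  split v with r ≟ v
  ... | yes refl rewrite Pr = refl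
  ... | no _     = sym (trans (+-identityʳ _) (cong 𝟙 (∧-identityʳ (P v))))

count-pos : ∀ {n} (P : Fin n → Bool) → 1 ≤ count P → ∃ λ v → P v ≡ true
count-pos {suc n} P pos with P zero in P₀
... | true  = zero , P₀
... | false = let v , Pv = count-pos (P ∘ suc) pos in suc v , Pv

count-two : ∀ {n} (P : Fin n → Bool) → 2 ≤ count P → ∃ λ u → ∃ λ v → u ≢ v × P u ≡ true × P v ≡ true
count-two P two with u , Pu ← count-pos P (≤-trans (s≤s z≤n) two)
  with v , Pv∧v≢u ← count-pos (λ v → P v ∧ not ⌊ u ≟ v ⌋) (≤-pred (subst (2 ≤_) (count-remove P Pu) two))
  with Pv , u≢v ← ∧-true Pv∧v≢u = u , v , ≟-not u≢v , Pu , Pv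

∣p∣≡count : ∀ {n} (p : Subset n) → ∣ p ∣ ≡ count (lookup p)
∣p∣≡count []            = refl
∣p∣≡count (inside ∷ p)  = cong suc (∣p∣≡count p)
∣p∣≡count (outside ∷ p) = ∣p∣≡count p

-- Degrees and the handshake lemma

edgeCount≡sum : ∀ {n} (E : Fin n → Fin n → Bool) →
                edgeCount E ≡ sum (λ u → count (λ v → (toℕ u <ᵇ toℕ v) ∧ E u v))
edgeCount≡sum {n} E =
  trans (sum-allFin (λ u → List.sum (map (below u) (allFin n))))
        (sum-cong-≗ (λ u → sum-allFin (below u)))
  where
  below : Fin n → Fin n → ℕ
  below u v = 𝟙 ((toℕ u <ᵇ toℕ v) ∧ E u v)

∑∑-sym : ∀ {n} (f : Fin n → Fin n → ℕ) →
         sum (λ u → sum (λ v → f u v + f v u)) ≡ 2 * sum (λ u → sum (f u))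
∑∑-sym f = begin
  sum (λ u → sum (λ v → f u v + f v u))       ≡⟨ sum-cong-≗ (λ u → ∑-distrib-+ (f u) (λ v → f v u)) ⟩
  sum (λ u → sum (f u) + sum (λ v → f v u))   ≡⟨ ∑-distrib-+ (λ u → sum (f u)) (λ u → sum (λ v → f v u)) ⟩
  A + sum (λ u → sum (λ v → f v u))           ≡⟨ cong (A +_) (∑-comm (λ u v → f v u)) ⟩
  A + A                                       ≡⟨ cong (A +_) (+-identityʳ A) ⟨
  2 * A                                       ∎
  where
  open ≡-Reasoning
  A : ℕ
  A = sum (λ u → sum (f u))

handshake : ∀ {n} (E : Fin n → Fin n → Bool) →
            (∀ u v → E u v ≡ E v u) → (∀ v → E v v ≡ false) →
            sum (λ u → count (E u)) ≡ 2 * edgeCount E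
handshake {n} E E-sym E-irrefl = begin
  sum (λ u → count (E u))                           ≡⟨ sum-cong-≗ (λ u → sum-cong-≗ (split u)) ⟩
  sum (λ u → sum (λ v → below u v + below v u))     ≡⟨ ∑∑-sym below ⟩
  2 * sum (λ u → sum (below u))                     ≡⟨ cong (2 *_) (edgeCount≡sum E) ⟨
  2 * edgeCount E                                   ∎
  where
  open ≡-Reasoning
  below : Fin n → Fin n → ℕ
  below u v = 𝟙 ((toℕ u <ᵇ toℕ v) ∧ E u v)
  by-order : ∀ x y e → (x ≡ y → e ≡ false) → 𝟙 e ≡ 𝟙 ((x <ᵇ y) ∧ e) + 𝟙 ((y <ᵇ x) ∧ e)
  by-order zero    zero    e x≡y⇒ rewrite x≡y⇒ refl = refl
  by-order zero    (suc y) e _    = sym (+-identityʳ (𝟙 e))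
  by-order (suc x) zero    e _    = refl
  by-order (suc x) (suc y) e h    = by-order x y e (h ∘ cong suc)
  split : ∀ u v → 𝟙 (E u v) ≡ below u v + below v u
  split u v rewrite E-sym v u =
    by-order (toℕ u) (toℕ v) (E u v) (λ eq → subst (λ w → E u w ≡ false) (toℕ-injective eq) (E-irrefl u))

edgeCount-sym-closure : ∀ {n} (R : Fin n → Fin n → Bool) → (∀ u v → R u v ≡ true → R v u ≡ false) →
                        edgeCount (λ u v → R u v ∨ R v u) ≡ sum (λ u → count (R u))
edgeCount-sym-closure {n} R asym = *-cancelˡ-≡ _ _ 2 (begin
  2 * edgeCount R̂                                 ≡⟨ handshake R̂ (λ u v → ∨-comm (R u v) (R v u)) irrefl ⟨
  sum (λ u → count (R̂ u))                         ≡⟨ sum-cong-≗ (λ u → sum-cong-≗ (split u)) ⟩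
  sum (λ u → sum (λ v → 𝟙 (R u v) + 𝟙 (R v u)))   ≡⟨ ∑∑-sym (λ u v → 𝟙 (R u v)) ⟩
  2 * sum (λ u → count (R u))                     ∎)
  where
  open ≡-Reasoning
  R̂ : Fin n → Fin n → Bool
  R̂ u v = R u v ∨ R v u
  irrefl : ∀ v → R̂ v v ≡ false
  irrefl v with R v v in eq
  ... | false = refl
  ... | true  = case trans (sym eq) (asym v v eq) of λ ()
  split : ∀ u v → 𝟙 (R̂ u v) ≡ 𝟙 (R u v) + 𝟙 (R v u)
  split u v with R u v in eq | R v u in eq′
  ... | true  | true  = case trans (sym eq′) (asym u v eq) of λ ()
  ... | true  | false = refl
  ... | false | _     = refl

edgeCount-mono : ∀ {n} {E E′ : Fin n → Fin n → Bool} → (∀ u v → E u v ≡ true → E′ u v ≡ true) →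
                 edgeCount E ≤ edgeCount E′
edgeCount-mono {E = E} {E′} E⊆E′ =
  subst₂ _≤_ (sym (edgeCount≡sum E)) (sym (edgeCount≡sum E′))
         (sum-mono-≤ (λ u → sum-mono-≤ (λ v → 𝟙-mono (below u v))))
  where
  below : ∀ u v → (toℕ u <ᵇ toℕ v) ∧ E u v ≡ true → (toℕ u <ᵇ toℕ v) ∧ E′ u v ≡ true
  below u v h with u<v , e ← ∧-true h = cong₂ _∧_ u<v (E⊆E′ u v e)

deg≡count : ∀ {n} (G : Graph n) v → deg G v ≡ count (adj G v)
deg≡count G v = sum-allFin (λ u → 𝟙 (adj G v u))

∑deg≡2*size : ∀ {n} (G : Graph n) → sum (deg G) ≡ 2 * size G
∑deg≡2*size G =
  trans (sum-cong-≗ (deg≡count G)) (handshake (adj G) (adj-sym G) (adj-irrefl G))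

deg-complement : ∀ {n} (G : Graph n) v → suc (deg (complement G) v + deg G v) ≡ n
deg-complement {n} G v = begin
  suc (deg (complement G) v + deg G v)
    ≡⟨ +-comm 1 _ ⟩
  deg (complement G) v + deg G v + 1
    ≡⟨ cong₂ (λ x y → x + y + 1) (deg≡count (complement G) v) (deg≡count G v) ⟩
  count non + count nbr + 1
    ≡⟨ cong (count non + count nbr +_) (count-≟ v) ⟨
  count non + count nbr + count self
    ≡⟨ +-assoc (count non) (count nbr) (count self) ⟩
  count non + (count nbr + count self)
    ≡⟨ cong (count non +_) (∑-distrib-+ (𝟙 ∘ nbr) (𝟙 ∘ self)) ⟨
  count non + sum (λ u → 𝟙 (nbr u) + 𝟙 (self u))
    ≡⟨ ∑-distrib-+ (𝟙 ∘ non) (λ u → 𝟙 (nbr u) + 𝟙 (self u)) ⟨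
  sum (λ u → 𝟙 (non u) + (𝟙 (nbr u) + 𝟙 (self u)))
    ≡⟨ sum-cong-≗ (λ u → trichotomy (adj G v u) (self u) (loopless u)) ⟩
  sum {n} (λ _ → 1)
    ≡⟨ trans (sum-const n 1) (*-identityʳ n) ⟩
  n ∎
  where
  open ≡-Reasoning
  nbr self non : Fin n → Bool
  nbr u  = adj G v u
  self u = ⌊ v ≟ u ⌋
  non u  = not (nbr u) ∧ not (self u)
  loopless : ∀ u → self u ≡ true → nbr u ≡ false
  loopless u v≡u with v ≟ u
  ... | yes refl = adj-irrefl G v
  trichotomy : ∀ a e → (e ≡ true → a ≡ false) → 𝟙 (not a ∧ not e) + (𝟙 a + 𝟙 e) ≡ 1
  trichotomy true  true  h with () ← h refl
  trichotomy true  false _ = refl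
  trichotomy false true  _ = refl
  trichotomy false false _ = refl

∑deg+∑degᶜ : ∀ {n} (G : Graph n) → sum (deg G) + sum (deg (complement G)) ≡ n * (n ∸ 1)
∑deg+∑degᶜ {n} G = begin
  sum (deg G) + sum (deg (complement G))        ≡⟨ ∑-distrib-+ (deg G) (deg (complement G)) ⟨
  sum (λ v → deg G v + deg (complement G) v)    ≡⟨ sum-cong-≗ pointwise ⟩
  sum {n} (λ _ → n ∸ 1)                         ≡⟨ sum-const n (n ∸ 1) ⟩
  n * (n ∸ 1)                                   ∎
  where
  open ≡-Reasoning
  pointwise : ∀ v → deg G v + deg (complement G) v ≡ n ∸ 1
  pointwise v = trans (+-comm (deg G v) _) (cong (_∸ 1) (deg-complement G v))

sumOver : ∀ {n} → Subset n → (Fin n → ℕ) → ℕ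
sumOver []            x = 0
sumOver (inside ∷ S)  x = x zero + sumOver S (x ∘ suc)
sumOver (outside ∷ S) x = sumOver S (x ∘ suc)

prodOver : ∀ {n} → Subset n → (Fin n → ℕ) → ℕ
prodOver []            x = 1
prodOver (inside ∷ S)  x = x zero * prodOver S (x ∘ suc)
prodOver (outside ∷ S) x = prodOver S (x ∘ suc)

degProd≡prodOver : ∀ {n} (G : Graph n) S → degProd G S ≡ prodOver S (deg G)
degProd≡prodOver G S =
  trans (cong List.product (map-tabulate (λ v → v) (λ v → if lookup S v then deg G v else 1)))
        (masked S (deg G))
  where
  masked : ∀ {n} (S : Subset n) x →
           List.product (tabulate (λ v → if lookup S v then x v else 1)) ≡ prodOver S x
  masked []            x = refl
  masked (inside ∷ S)  x = cong (x zero *_) (masked S (x ∘ suc))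
  masked (outside ∷ S) x = trans (*-identityˡ _) (masked S (x ∘ suc))

sumOver-1 : ∀ {n} (S : Subset n) → sumOver S (λ _ → 1) ≡ ∣ S ∣
sumOver-1 []            = refl
sumOver-1 (inside ∷ S)  = cong suc (sumOver-1 S)
sumOver-1 (outside ∷ S) = sumOver-1 S

∣S∣≡0⇒sumOver≡0 : ∀ {n} (S : Subset n) x → ∣ S ∣ ≡ 0 → sumOver S x ≡ 0
∣S∣≡0⇒sumOver≡0 []            x _ = refl
∣S∣≡0⇒sumOver≡0 (outside ∷ S) x e = ∣S∣≡0⇒sumOver≡0 S (x ∘ suc) e

prodOver≤^ : ∀ {n} (S : Subset n) {x M} → (∀ v → x v ≤ M) → prodOver S x ≤ M ^ ∣ S ∣
prodOver≤^ []            x≤M = ≤-refl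
prodOver≤^ (inside ∷ S)  x≤M = *-mono-≤ (x≤M zero) (prodOver≤^ S (x≤M ∘ suc))
prodOver≤^ (outside ∷ S) x≤M = prodOver≤^ S (x≤M ∘ suc)

^≤prodOver : ∀ {n} (S : Subset n) {x M} → (∀ v → M ≤ x v) → M ^ ∣ S ∣ ≤ prodOver S x
^≤prodOver []            M≤x = ≤-refl
^≤prodOver (inside ∷ S)  M≤x = *-mono-≤ (M≤x zero) (^≤prodOver S (M≤x ∘ suc))
^≤prodOver (outside ∷ S) M≤x = ^≤prodOver S (M≤x ∘ suc)

∣S∣*prodOver≤^*sumOver : ∀ {n} (S : Subset n) {x M} → (∀ v → x v ≤ M) →
               ∣ S ∣ * prodOver S x ≤ M ^ (∣ S ∣ ∸ 1) * sumOver S x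
∣S∣*prodOver≤^*sumOver []            x≤M = z≤n
∣S∣*prodOver≤^*sumOver (outside ∷ S) x≤M = ∣S∣*prodOver≤^*sumOver S (x≤M ∘ suc)
∣S∣*prodOver≤^*sumOver (inside ∷ S) {x} {M} x≤M =
  grow ∣ S ∣ (prodOver≤^ S (x≤M ∘ suc)) (∣S∣*prodOver≤^*sumOver S (x≤M ∘ suc))
  where
  open ≤-Reasoning
  x₀ P Σ′ : ℕ
  x₀ = x zero
  P = prodOver S (x ∘ suc)
  Σ′ = sumOver S (x ∘ suc)
  grow : ∀ c → P ≤ M ^ c → c * P ≤ M ^ (c ∸ 1) * Σ′ → suc c * (x₀ * P) ≤ M ^ c * (x₀ + Σ′)
  grow c P≤ cP≤ = begin
    suc c * (x₀ * P)        ≡⟨ cong (x₀ * P +_) (x∙yz≈y∙xz c x₀ P) ⟩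
    x₀ * P + x₀ * (c * P)   ≤⟨ +-mono-≤ (*-monoʳ-≤ x₀ P≤) (rest c cP≤) ⟩
    x₀ * M ^ c + M ^ c * Σ′ ≡⟨ cong (_+ M ^ c * Σ′) (*-comm x₀ (M ^ c)) ⟩
    M ^ c * x₀ + M ^ c * Σ′ ≡⟨ *-distribˡ-+ (M ^ c) x₀ Σ′ ⟨
    M ^ c * (x₀ + Σ′)       ∎
    where
    rest : ∀ c → c * P ≤ M ^ (c ∸ 1) * Σ′ → x₀ * (c * P) ≤ M ^ c * Σ′
    rest zero    _   = ≤-trans (≤-reflexive (*-zeroʳ x₀)) z≤n
    rest (suc c) cP≤ = begin
      x₀ * (suc c * P)    ≤⟨ *-mono-≤ (x≤M zero) cP≤ ⟩
      M * (M ^ c * Σ′)    ≡⟨ *-assoc M (M ^ c) Σ′ ⟨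
      M ^ suc c * Σ′      ∎

^*sumOver≤∣S∣*prodOver : ∀ {n} (S : Subset n) {x M} → (∀ v → M ≤ x v) →
               M ^ (∣ S ∣ ∸ 1) * sumOver S x ≤ ∣ S ∣ * prodOver S x
^*sumOver≤∣S∣*prodOver []            M≤x = z≤n
^*sumOver≤∣S∣*prodOver (outside ∷ S) M≤x = ^*sumOver≤∣S∣*prodOver S (M≤x ∘ suc)
^*sumOver≤∣S∣*prodOver (inside ∷ S) {x} {M} M≤x =
  grow ∣ S ∣ refl (^≤prodOver S (M≤x ∘ suc)) (^*sumOver≤∣S∣*prodOver S (M≤x ∘ suc))
  where
  open ≤-Reasoning
  x₀ P Σ′ : ℕ
  x₀ = x zero
  P = prodOver S (x ∘ suc)
  Σ′ = sumOver S (x ∘ suc)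
  grow : ∀ c → c ≡ ∣ S ∣ → M ^ c ≤ P → M ^ (c ∸ 1) * Σ′ ≤ c * P → M ^ c * (x₀ + Σ′) ≤ suc c * (x₀ * P)
  grow c c≡ ≤P ≤cP = begin
    M ^ c * (x₀ + Σ′)       ≡⟨ *-distribˡ-+ (M ^ c) x₀ Σ′ ⟩
    M ^ c * x₀ + M ^ c * Σ′ ≡⟨ cong (_+ M ^ c * Σ′) (*-comm (M ^ c) x₀) ⟩
    x₀ * M ^ c + M ^ c * Σ′ ≤⟨ +-mono-≤ (*-monoʳ-≤ x₀ ≤P) (rest c c≡ ≤cP) ⟩
    x₀ * P + x₀ * (c * P)   ≡⟨ cong (x₀ * P +_) (x∙yz≈y∙xz c x₀ P) ⟨
    suc c * (x₀ * P)        ∎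
    where
    rest : ∀ c → c ≡ ∣ S ∣ → M ^ (c ∸ 1) * Σ′ ≤ c * P → M ^ c * Σ′ ≤ x₀ * (c * P)
    rest zero    c≡ _   rewrite ∣S∣≡0⇒sumOver≡0 S (x ∘ suc) (sym c≡) = z≤n
    rest (suc c) _  ≤cP = begin
      M ^ suc c * Σ′      ≡⟨ *-assoc M (M ^ c) Σ′ ⟩
      M * (M ^ c * Σ′)    ≤⟨ *-mono-≤ (M≤x zero) ≤cP ⟩
      x₀ * (suc c * P)    ∎

∈⇒≤prodOver : ∀ {n} {S : Subset n} {x v} → (∀ u → 1 ≤ x u) → v ∈ S → x v ≤ prodOver S x
∈⇒≤prodOver {S = inside ∷ S} {x} 1≤x here =
  subst (_≤ x zero * prodOver S (x ∘ suc)) (*-identityʳ (x zero))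
        (*-monoʳ-≤ (x zero) (subst (_≤ prodOver S (x ∘ suc)) (^-zeroˡ ∣ S ∣) (^≤prodOver S (1≤x ∘ suc))))
∈⇒≤prodOver {S = inside ∷ S} {x} 1≤x (there v∈S) =
  ≤-trans (∈⇒≤prodOver (1≤x ∘ suc) v∈S) (m≤n*m _ (x zero) {{>-nonZero (1≤x zero)}})
∈⇒≤prodOver {S = outside ∷ S} 1≤x (there v∈S) = ∈⇒≤prodOver (1≤x ∘ suc) v∈S

sumSized : ∀ {n} → List (Subset n) → ℕ → (Subset n → ℕ) → ℕ
sumSized L k g = List.sum (map (λ S → if ∣ S ∣ ≡ᵇ k then g S else 0) L)

sumSized-mono : ∀ {n} (L : List (Subset n)) k {g h : Subset n → ℕ} →
                (∀ S → ∣ S ∣ ≡ k → g S ≤ h S) → sumSized L k g ≤ sumSized L k h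
sumSized-mono []      k g≤h = z≤n
sumSized-mono (S ∷ L) k g≤h with ∣ S ∣ ≡ᵇ k in eq
... | true  = +-mono-≤ (g≤h S (≡ᵇ⇒≡ ∣ S ∣ k (subst T (sym eq) tt))) (sumSized-mono L k g≤h)
... | false = sumSized-mono L k g≤h

sumSized-cong : ∀ {n} (L : List (Subset n)) k {g h : Subset n → ℕ} →
                (∀ S → ∣ S ∣ ≡ k → g S ≡ h S) → sumSized L k g ≡ sumSized L k h
sumSized-cong L k g≡h = ≤-antisym (sumSized-mono L k (λ S → ≤-reflexive ∘ g≡h S))
                                  (sumSized-mono L k (λ S → ≤-reflexive ∘ sym ∘ g≡h S))

sumSized-+ : ∀ {n} (L : List (Subset n)) k (g h : Subset n → ℕ) →
             sumSized L k (λ S → g S + h S) ≡ sumSized L k g + sumSized L k h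
sumSized-+ []      k g h = refl
sumSized-+ (S ∷ L) k g h with ∣ S ∣ ≡ᵇ k
... | true  = trans (cong (g S + h S +_) (sumSized-+ L k g h)) (+-interchange (g S) (h S) _ _)
... | false = sumSized-+ L k g h

sumSized-* : ∀ {n} (L : List (Subset n)) k c (g : Subset n → ℕ) →
             sumSized L k (λ S → c * g S) ≡ c * sumSized L k g
sumSized-* []      k c g = sym (*-zeroʳ c)
sumSized-* (S ∷ L) k c g with ∣ S ∣ ≡ᵇ k
... | true  = trans (cong (c * g S +_) (sumSized-* L k c g)) (sym (*-distribˡ-+ c (g S) _))
... | false = sumSized-* L k c g

sum-allSubsets-suc : ∀ n (h : Subset (suc n) → ℕ) →
  List.sum (map h (allSubsets (suc n))) ≡
  List.sum (map (h ∘ (inside ∷_)) (allSubsets n)) + List.sum (map (h ∘ (outside ∷_)) (allSubsets n))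
sum-allSubsets-suc n h = begin
  List.sum (map h (map (inside ∷_) L ++ map (outside ∷_) L))
    ≡⟨ cong List.sum (map-++ h (map (inside ∷_) L) (map (outside ∷_) L)) ⟩
  List.sum (map h (map (inside ∷_) L) ++ map h (map (outside ∷_) L))
    ≡⟨ sum-++ (map h (map (inside ∷_) L)) (map h (map (outside ∷_) L)) ⟩
  List.sum (map h (map (inside ∷_) L)) + List.sum (map h (map (outside ∷_) L))
    ≡⟨ cong₂ _+_ (cong List.sum (map-∘ L)) (cong List.sum (map-∘ L)) ⟨
  List.sum (map (h ∘ (inside ∷_)) L) + List.sum (map (h ∘ (outside ∷_)) L) ∎
  where
  open ≡-Reasoning
  L : List (Subset n)
  L = allSubsets n

sumSized-suc : ∀ n k (g : Subset (suc n) → ℕ) →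
  sumSized (allSubsets (suc n)) (suc k) g ≡
  sumSized (allSubsets n) k (g ∘ (inside ∷_)) + sumSized (allSubsets n) (suc k) (g ∘ (outside ∷_))
sumSized-suc n k g = sum-allSubsets-suc n (λ S → if ∣ S ∣ ≡ᵇ suc k then g S else 0)

sumSized-zero : ∀ n (g : Subset (suc n) → ℕ) →
  sumSized (allSubsets (suc n)) 0 g ≡ sumSized (allSubsets n) 0 (g ∘ (outside ∷_))
sumSized-zero n g =
  trans (sum-allSubsets-suc n (λ S → if ∣ S ∣ ≡ᵇ 0 then g S else 0))
        (cong (_+ sumSized (allSubsets n) 0 (g ∘ (outside ∷_))) (zeros (allSubsets n)))
  where
  zeros : ∀ {A : Set} (L : List A) → List.sum (map (λ _ → 0) L) ≡ 0
  zeros []      = refl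
  zeros (_ ∷ L) = zeros L

sumSized-1≡C : ∀ n k → sumSized (allSubsets n) k (λ _ → 1) ≡ n C k
sumSized-1≡C zero    zero    = refl
sumSized-1≡C zero    (suc k) = refl
sumSized-1≡C (suc n) zero    = trans (sumSized-zero n (λ _ → 1)) (sumSized-1≡C n zero)
sumSized-1≡C (suc n) (suc k) = begin
  sumSized (allSubsets (suc n)) (suc k) (λ _ → 1)   ≡⟨ sumSized-suc n k (λ _ → 1) ⟩
  sumSized (allSubsets n) k (λ _ → 1) + sumSized (allSubsets n) (suc k) (λ _ → 1)
                                                   ≡⟨ cong₂ _+_ (sumSized-1≡C n k) (sumSized-1≡C n (suc k)) ⟩
  n C k + n C suc k                                ≡⟨ nCk+nC[k+1]≡[n+1]C[k+1] n k ⟩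
  suc n C suc k                                    ∎
  where open ≡-Reasoning

sumSized-const : ∀ n k c → sumSized (allSubsets n) k (λ _ → c) ≡ c * (n C k)
sumSized-const n k c = begin
  sumSized (allSubsets n) k (λ _ → c)       ≡⟨ sumSized-cong (allSubsets n) k (λ _ _ → *-identityʳ c) ⟨
  sumSized (allSubsets n) k (λ _ → c * 1)   ≡⟨ sumSized-* (allSubsets n) k c (λ _ → 1) ⟩
  c * sumSized (allSubsets n) k (λ _ → 1)   ≡⟨ cong (c *_) (sumSized-1≡C n k) ⟩
  c * (n C k)                              ∎
  where open ≡-Reasoning

sumSized-zero-sumOver : ∀ n (f : Fin n → ℕ) → sumSized (allSubsets n) 0 (λ S → sumOver S f) ≡ 0
sumSized-zero-sumOver n f =
  trans (sumSized-cong (allSubsets n) 0 (λ S → ∣S∣≡0⇒sumOver≡0 S f)) (sumSized-const n 0 0)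

sumSized-sumOver-suc : ∀ n k (f : Fin (suc n) → ℕ) →
  sumSized (allSubsets (suc n)) (suc k) (λ S → sumOver S f) ≡
  f zero * (n C k) + sumSized (allSubsets n) k (λ S → sumOver S (f ∘ suc))
                   + sumSized (allSubsets n) (suc k) (λ S → sumOver S (f ∘ suc))
sumSized-sumOver-suc n k f = begin
  sumSized (allSubsets (suc n)) (suc k) (λ S → sumOver S f)
    ≡⟨ sumSized-suc n k (λ S → sumOver S f) ⟩
  sumSized (allSubsets n) k (λ S → f zero + sumOver S f′) + rest
    ≡⟨ cong (_+ rest) (sumSized-+ (allSubsets n) k (λ _ → f zero) (λ S → sumOver S f′)) ⟩
  sumSized (allSubsets n) k (λ _ → f zero) + sumSized (allSubsets n) k (λ S → sumOver S f′) + rest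
    ≡⟨ cong (λ x → x + sumSized (allSubsets n) k (λ S → sumOver S f′) + rest) (sumSized-const n k (f zero)) ⟩
  f zero * (n C k) + sumSized (allSubsets n) k (λ S → sumOver S f′) + rest ∎
  where
  open ≡-Reasoning
  f′ : Fin n → ℕ
  f′ = f ∘ suc
  rest : ℕ
  rest = sumSized (allSubsets n) (suc k) (λ S → sumOver S f′)

-- Each point of an (n+1)-set lies in exactly  n C k  of its (k+1)-subsets.
sumSized-sumOver : ∀ n k (f : Fin (suc n) → ℕ) →
  sumSized (allSubsets (suc n)) (suc k) (λ S → sumOver S f) ≡ (n C k) * sum f
sumSized-sumOver zero k f = trans (sumSized-sumOver-suc zero k f) (base k)
  where
  identity : ∀ x c → x * c + 0 + 0 ≡ c * (x + 0)
  identity = solve-∀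
  base : ∀ k → f zero * (0 C k) + sumSized (allSubsets 0) k (λ S → sumOver S (f ∘ suc))
                 + sumSized (allSubsets 0) (suc k) (λ S → sumOver S (f ∘ suc)) ≡ (0 C k) * (f zero + 0)
  base zero    = identity (f zero) (0 C 0)
  base (suc k) = identity (f zero) (0 C suc k)
sumSized-sumOver (suc n) k f = begin
  sumSized (allSubsets (suc (suc n))) (suc k) (λ S → sumOver S f)
    ≡⟨ sumSized-sumOver-suc (suc n) k f ⟩
  f₀ * (suc n C k) + sumSized (allSubsets (suc n)) k (λ S → sumOver S f′)
                   + sumSized (allSubsets (suc n)) (suc k) (λ S → sumOver S f′)
    ≡⟨ cong (f₀ * (suc n C k) + sumSized (allSubsets (suc n)) k (λ S → sumOver S f′) +_)
            (sumSized-sumOver n k f′) ⟩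
  f₀ * (suc n C k) + sumSized (allSubsets (suc n)) k (λ S → sumOver S f′) + (n C k) * sum f′
    ≡⟨ combine k ⟩
  (suc n C k) * (f₀ + sum f′) ∎
  where
  open ≡-Reasoning
  f₀ : ℕ
  f₀ = f zero
  f′ : Fin (suc n) → ℕ
  f′ = f ∘ suc
  combine : ∀ k → f₀ * (suc n C k) + sumSized (allSubsets (suc n)) k (λ S → sumOver S f′) + (n C k) * sum f′
                  ≡ (suc n C k) * (f₀ + sum f′)
  combine zero rewrite sumSized-zero-sumOver (suc n) f′ = identity f₀ (sum f′)
    where identity : ∀ x y → x * 1 + 0 + 1 * y ≡ 1 * (x + y)
          identity = solve-∀
  combine (suc k) rewrite sumSized-sumOver n k f′ | sym (nCk+nC[k+1]≡[n+1]C[k+1] n k) =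
    identity f₀ (sum f′) (n C k) (n C suc k)
    where identity : ∀ x y a b → x * (a + b) + a * y + b * y ≡ (a + b) * (x + y)
          identity = solve-∀

sumSized-*-sumOver : ∀ n k c (f : Fin (suc n) → ℕ) →
  sumSized (allSubsets (suc n)) (suc k) (λ S → c * sumOver S f) ≡ c * (n C k) * sum f
sumSized-*-sumOver n k c f = begin
  sumSized (allSubsets (suc n)) (suc k) (λ S → c * sumOver S f) ≡⟨ sumSized-* (allSubsets (suc n)) (suc k) c _ ⟩
  c * sumSized (allSubsets (suc n)) (suc k) (λ S → sumOver S f) ≡⟨ cong (c *_) (sumSized-sumOver n k f) ⟩
  c * ((n C k) * sum f)                                        ≡⟨ *-assoc c (n C k) (sum f) ⟨
  c * (n C k) * sum f                                          ∎
  where open ≡-Reasoning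

[1+n]*nCk≡[1+k]*[1+n]C[1+k] : ∀ n k → suc n * (n C k) ≡ suc k * (suc n C suc k)
[1+n]*nCk≡[1+k]*[1+n]C[1+k] n k = begin
  suc n * (n C k)                                         ≡⟨ *-comm (suc n) (n C k) ⟩
  (n C k) * suc n                                         ≡⟨ cong ((n C k) *_) (trans (sum-const (suc n) 1) (*-identityʳ (suc n))) ⟨
  (n C k) * sum {suc n} (λ _ → 1)                         ≡⟨ sumSized-sumOver n k (λ _ → 1) ⟨
  sumSized (allSubsets (suc n)) (suc k) (λ S → sumOver S (λ _ → 1))
                                                          ≡⟨ sumSized-cong (allSubsets (suc n)) (suc k) (λ S → trans (sumOver-1 S)) ⟩
  sumSized (allSubsets (suc n)) (suc k) (λ _ → suc k)     ≡⟨ sumSized-const (suc n) (suc k) (suc k) ⟩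
  suc k * (suc n C suc k)                                 ∎
  where open ≡-Reasoning

Reach-++ : ∀ {n} {E : Fin n → Fin n → Bool} {u v w} → Reach E u v → Reach E v w → Reach E u w
Reach-++ here       q = q
Reach-++ (step e p) q = step e (Reach-++ p q)

Reach-reverse : ∀ {n} {E : Fin n → Fin n → Bool} → (∀ u v → E u v ≡ E v u) →
                ∀ {u v} → Reach E u v → Reach E v u
Reach-reverse {E = E} E-sym p = go p here
  where
  go : ∀ {u v w} → Reach E u v → Reach E u w → Reach E v w
  go here       acc = acc
  go (step e p) acc = go p (step (trans (E-sym _ _) e) acc)

Reach-first-step : ∀ {n} {E : Fin n → Fin n → Bool} {u v} → Reach E u v → u ≢ v → ∃ λ w → E u w ≡ true
Reach-first-step here                u≢v = ⊥-elim (u≢v refl)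
Reach-first-step (step {w = w} e _) _   = w , e

Reach-preserves : ∀ {n} {E : Fin n → Fin n → Bool} (P : Fin n → Set) →
                  (∀ {u v} → P u → E u v ≡ true → P v) → ∀ {u v} → Reach E u v → P u → P v
Reach-preserves P closed here       Pu = Pu
Reach-preserves P closed (step e p) Pu = Reach-preserves P closed p (closed Pu e)

-- Breadth-first spanning trees

anyᵇ : ∀ {n} → (Fin n → Bool) → Bool
anyᵇ {zero}  p = false
anyᵇ {suc n} p = p zero ∨ anyᵇ (p ∘ suc)

anyᵇ-intro : ∀ {n} (p : Fin n → Bool) {u} → p u ≡ true → anyᵇ p ≡ true
anyᵇ-intro p {zero}  pu rewrite pu = refl
anyᵇ-intro p {suc u} pu rewrite anyᵇ-intro (p ∘ suc) pu = ∨-zeroʳ (p zero)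

anyᵇ-elim : ∀ {n} (p : Fin n → Bool) → anyᵇ p ≡ true → ∃ λ u → p u ≡ true
anyᵇ-elim {suc n} p any with p zero in eq
... | true  = zero , eq
... | false = let u , pu = anyᵇ-elim (p ∘ suc) any in suc u , pu

-- The least  s ≤ t  with  P s, or  t  if there is none.
least : (ℕ → Bool) → ℕ → ℕ
least P zero    = 0
least P (suc t) = if P 0 then 0 else suc (least (P ∘ suc) t)

least-holds : ∀ (P : ℕ → Bool) t → P t ≡ true → P (least P t) ≡ true
least-holds P zero    Pt = Pt
least-holds P (suc t) Pt with P 0 in eq
... | true  = eq
... | false = least-holds (P ∘ suc) t Pt

least-minimal : ∀ (P : ℕ → Bool) t {s} → s < least P t → P s ≡ false
least-minimal P (suc t) {s} s< with P 0 in eq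
least-minimal P (suc t) {zero}  s<        | false = eq
least-minimal P (suc t) {suc s} (s≤s s<) | false = least-minimal (P ∘ suc) t s<

least-≤ : ∀ (P : ℕ → Bool) t {s} → P s ≡ true → least P t ≤ s
least-≤ P t {s} Ps = ≮⇒≥ λ s< → case trans (sym Ps) (least-minimal P t s<) of λ ()

-- For a set D of vertices that is closed under E and in which every vertex reaches r, each
-- vertex of D other than r gets as parent a neighbour of smaller BFS depth; these parent edges
-- form a spanning tree of D with |D| − 1 edges.
module SpanningTree {n} (E : Fin n → Fin n → Bool) (E-sym : ∀ u v → E u v ≡ E v u)
                    (D : Fin n → Bool) (r : Fin n)
                    (reach  : ∀ {v} → D v ≡ true → Reach E v r)
                    (closed : ∀ {u v} → D u ≡ true → E u v ≡ true → D v ≡ true) where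

  ball : ℕ → Fin n → Bool
  ball zero    v = ⌊ r ≟ v ⌋
  ball (suc t) v = ball t v ∨ anyᵇ (λ u → E v u ∧ ball t u)

  Reach⇒ball : ∀ {v} → Reach E v r → ∃ λ t → ball t v ≡ true
  Reach⇒ball here = 0 , ≟-refl r
  Reach⇒ball {v} (step {w = w} e p) with t , w∈ball ← Reach⇒ball p =
    suc t , trans (cong (ball t v ∨_) (anyᵇ-intro (λ u → E v u ∧ ball t u) Evw∧)) (∨-zeroʳ _)
    where Evw∧ : E v w ∧ ball t w ≡ true
          Evw∧ rewrite e | w∈ball = refl

  -- the bound for the search of the depth of v, with the junk value 0 outside D
  radius′ : ∀ v b → D v ≡ b → ℕ
  radius′ v true  v∈D = proj₁ (Reach⇒ball (reach v∈D))
  radius′ v false _   = 0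

  radius : Fin n → ℕ
  radius v = radius′ v (D v) refl

  ball-radius : ∀ {v} → D v ≡ true → ball (radius v) v ≡ true
  ball-radius {v} = go (D v) refl
    where
    go : ∀ b (eq : D v ≡ b) → b ≡ true → ball (radius′ v b eq) v ≡ true
    go true eq _ = proj₂ (Reach⇒ball (reach eq))

  depth : Fin n → ℕ
  depth v = least (λ t → ball t v) (radius v)

  ball-depth : ∀ {v} → D v ≡ true → ball (depth v) v ≡ true
  ball-depth {v} v∈D = least-holds (λ t → ball t v) (radius v) (ball-radius v∈D)

  depth-≤ : ∀ {v t} → ball t v ≡ true → depth v ≤ t
  depth-≤ {v} = least-≤ (λ t → ball t v) (radius v)

  Towards : Fin n → Fin n → Bool
  Towards v u = E v u ∧ ball (depth v ∸ 1) u

  Towards-exists : ∀ {v} → D v ≡ true → v ≢ r → ∃ λ u → Towards v u ≡ true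
  Towards-exists {v} v∈D v≢r with depth v in eq | ball-depth v∈D
  ... | zero  | v∈ball₀ = ⊥-elim (v≢r (sym (≟-true v∈ball₀)))
  ... | suc t | v∈ball with ball t v in v∈ballₜ
  ...   | true  =
    case trans (sym v∈ballₜ) (least-minimal (λ t → ball t v) (radius v) (≤-reflexive (sym eq))) of λ ()
  ...   | false = anyᵇ-elim (λ u → E v u ∧ ball t u) v∈ball

  depth-pred : ∀ {v} → D v ≡ true → v ≢ r → suc (depth v ∸ 1) ≡ depth v
  depth-pred {v} v∈D v≢r with depth v | ball-depth v∈D
  ... | zero  | v∈ball₀ = ⊥-elim (v≢r (sym (≟-true v∈ball₀)))
  ... | suc t | _       = refl

  NonRoot : Fin n → Bool
  NonRoot v = D v ∧ not ⌊ r ≟ v ⌋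

  parentᵇ : ∀ {v} → Dec (∃ λ u → Towards v u ≡ true) → Fin n → Bool
  parentᵇ (yes (u , _)) w = ⌊ u ≟ w ⌋
  parentᵇ (no _)        w = false

  Parent : Fin n → Fin n → Bool
  Parent v w = NonRoot v ∧ parentᵇ (any? (λ u → Towards v u Bool.≟ true)) w

  Parent-sound : ∀ {v w} → Parent v w ≡ true → E v w ≡ true × D w ≡ true × depth w < depth v
  Parent-sound {v} {w} p with any? (λ u → Towards v u Bool.≟ true) | p
  ... | yes (u , towards) | p′
    with nonroot , u≟w ← ∧-true p′
    with refl ← ≟-true {u = u} {v = w} u≟w
    with v∈D , r≢v ← ∧-true nonroot
    with Evw , w∈ball ← ∧-true towards =
    Evw , closed v∈D Evw , subst (depth w <_) (depth-pred v∈D (≟-not r≢v ∘ sym)) (s≤s (depth-≤ w∈ball))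
  ... | no _ | p′ with () ← proj₂ (∧-true {NonRoot v} {false} p′)

  count-Parent : ∀ v → count (Parent v) ≡ 𝟙 (NonRoot v)
  count-Parent v with NonRoot v in nonroot | any? (λ u → Towards v u Bool.≟ true)
  ... | false | _            = count-false {n}
  ... | true  | yes (u , _)  = count-≟ u
  ... | true  | no no-parent = ⊥-elim (no-parent (Towards-exists v∈D (≟-not r≢v ∘ sym)))
    where v∈D : D v ≡ true
          v∈D = proj₁ (∧-true nonroot)
          r≢v : not ⌊ r ≟ v ⌋ ≡ true
          r≢v = proj₂ (∧-true nonroot)

  parent-exists : ∀ {v} → D v ≡ true → v ≢ r → ∃ λ w → Parent v w ≡ true
  parent-exists {v} v∈D v≢r with NonRoot v in nonroot | any? (λ u → Towards v u Bool.≟ true)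
  ... | true  | yes (u , _)  = u , ≟-refl u
  ... | true  | no no-parent = ⊥-elim (no-parent (Towards-exists v∈D v≢r))
  ... | false | _ with () ← trans (sym nonroot) (cong₂ (λ a b → a ∧ not b) v∈D (≟-false (v≢r ∘ sym)))

  Tree : Fin n → Fin n → Bool
  Tree u v = Parent u v ∨ Parent v u

  Parent-asym : ∀ u v → Parent u v ≡ true → Parent v u ≡ false
  Parent-asym u v p with Parent v u in q
  ... | false = refl
  ... | true  = ⊥-elim (<-asym (proj₂ (proj₂ (Parent-sound p))) (proj₂ (proj₂ (Parent-sound q))))

  edgeCount-Tree : edgeCount Tree ≡ count NonRoot
  edgeCount-Tree = trans (edgeCount-sym-closure Parent Parent-asym) (sum-cong-≗ count-Parent)

  Tree⊆E : ∀ u v → Tree u v ≡ true → E u v ≡ true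
  Tree⊆E u v t with Parent u v in p | Parent v u in q
  ... | true  | _    = proj₁ (Parent-sound p)
  ... | false | true = trans (E-sym u v) (proj₁ (Parent-sound q))

  Tree-reach : ∀ {v} → D v ≡ true → Reach Tree v r
  Tree-reach {v} v∈D = go (suc (depth v)) v∈D ≤-refl
    where
    go : ∀ d {v} → D v ≡ true → depth v < d → Reach Tree v r
    go (suc d) {v} v∈D v<d with r ≟ v
    ... | yes refl = here
    ... | no r≢v
      with w , p ← parent-exists v∈D (r≢v ∘ sym)
      with _ , w∈D , w<v ← Parent-sound p =
      step (cong (_∨ Parent w v) p) (go d w∈D (≤-trans w<v (≤-pred v<d)))

-- Bounds on the Steiner distance

∣W∣≤1+edges : ∀ {n} {G : Graph n} {S} (H : ConnSubgraphContaining G S) → ∣ W H ∣ ≤ suc (edgesOf H)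
∣W∣≤1+edges {n} H with nonempty? (W H)
... | no empty = subst (_≤ suc (edgesOf H)) (trans (sym (∣⊥∣≡0 n)) (cong ∣_∣ (sym (Empty-unique empty))))
                       z≤n
... | yes (r , r∈W) = begin
  ∣ W H ∣                      ≡⟨ ∣p∣≡count (W H) ⟩
  count (lookup (W H))         ≡⟨ count-remove (lookup (W H)) ([]=⇒lookup r∈W) ⟩
  suc (count NonRoot)          ≡⟨ cong suc edgeCount-Tree ⟨
  suc (edgeCount Tree)         ≤⟨ s≤s (edgeCount-mono Tree⊆E) ⟩
  suc (edgesOf H)              ∎
  where
  open ≤-Reasoning
  open SpanningTree (F H) (F-sym H) (lookup (W H)) r
         (λ {v} v∈W → W-conn H v r (lookup⇒[]= v (W H) v∈W) r∈W)
         (λ {u} {v} _ e → []=⇒lookup (proj₂ (F-ends H u v e)))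

spanning-subgraph : ∀ {n} {G : Graph (suc n)} → Connected G → ∀ S →
                    Σ[ H ∈ ConnSubgraphContaining G S ] edgesOf H ≡ n
spanning-subgraph {n} {G} connected S = H , suc-injective (begin
  suc (edgeCount Tree)         ≡⟨ cong suc edgeCount-Tree ⟩
  suc (count NonRoot)          ≡⟨ count-remove {suc n} (λ _ → true) {zero} refl ⟨
  count {suc n} (λ _ → true)   ≡⟨ trans (sum-const (suc n) 1) (*-identityʳ (suc n)) ⟩
  suc n                        ∎)
  where
  open ≡-Reasoning
  open SpanningTree (adj G) (adj-sym G) (λ _ → true) zero (λ {v} _ → connected v zero) (λ _ _ → refl)
  H : ConnSubgraphContaining G S
  H = record
    { W      = ⊤
    ; F      = Tree
    ; F-sym  = λ u v → ∨-comm (Parent u v) (Parent v u)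
    ; F⊆E    = Tree⊆E
    ; F-ends = λ _ _ _ → ∈⊤ , ∈⊤
    ; S⊆W    = λ _ → ∈⊤
    ; W-conn = λ u v _ _ → Reach-++ (Tree-reach refl)
                                    (Reach-reverse (λ u v → ∨-comm (Parent u v) (Parent v u)) (Tree-reach refl))
    }

∣S∣≤1+edges : ∀ {n} {G : Graph n} {S} (H : ConnSubgraphContaining G S) → ∣ S ∣ ≤ suc (edgesOf H)
∣S∣≤1+edges H = ≤-trans (p⊆q⇒∣p∣≤∣q∣ (S⊆W H)) (∣W∣≤1+edges H)

∣S∣≤1+steinerDist : ∀ {n} {G : Graph n} {S d} → SteinerDist G S d → ∣ S ∣ ≤ suc d
∣S∣≤1+steinerDist ((H , edges≡d) , _) = subst (λ e → _ ≤ suc e) edges≡d (∣S∣≤1+edges H)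

steinerDist≤n : ∀ {n} {G : Graph (suc n)} {S d} → Connected G → SteinerDist G S d → d ≤ n
steinerDist≤n {n} {G} {S} connected (_ , minimal) =
  ≤-trans (minimal (proj₁ spanning)) (≤-reflexive (proj₂ spanning))
  where spanning : Σ[ H ∈ ConnSubgraphContaining G S ] edgesOf H ≡ n
        spanning = spanning-subgraph connected S

steinerDist-spanning : ∀ {n} {G : Graph (suc n)} {S} → Connected G → ∣ S ∣ ≡ suc n → SteinerDist G S n
steinerDist-spanning {S = S} connected ∣S∣≡ =
  spanning-subgraph connected S ,
  λ H → ≤-pred (subst (_≤ suc (edgesOf H)) ∣S∣≡ (∣S∣≤1+edges H))

deg≥1 : ∀ {n} (G : Graph n) {v w} → adj G v w ≡ true → 1 ≤ deg G v
deg≥1 G {v} e = subst (1 ≤_) (sym (trans (deg≡count G v) (count-remove (adj G v) e))) (s≤s z≤n)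

connected⇒deg≥1 : ∀ {n} {G : Graph n} → Connected G → 2 ≤ n → ∀ v → 1 ≤ deg G v
connected⇒deg≥1 {suc zero} _ (s≤s ()) _
connected⇒deg≥1 {suc (suc n)} {G} connected _ zero =
  deg≥1 G (proj₂ (Reach-first-step (connected zero (suc zero)) λ ()))
connected⇒deg≥1 {suc (suc n)} {G} connected _ (suc v) =
  deg≥1 G (proj₂ (Reach-first-step (connected (suc v) zero) λ ()))

deg≡1-unique : ∀ {n} (G : Graph n) {v x y} → deg G v ≡ 1 →
               adj G v x ≡ true → adj G v y ≡ true → x ≡ y
deg≡1-unique G {v} {x} {y} deg≡1 vx vy with x ≟ y
... | yes x≡y = x≡y
... | no  x≢y =
  ⊥-elim (1+n≰n (subst (2 ≤_) (trans (sym (deg≡count G v)) deg≡1) (two-neighbours)))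
  where
  two-neighbours : 2 ≤ count (adj G v)
  two-neighbours = subst (2 ≤_) (sym (count-remove (adj G v) vx))
    (s≤s (subst (1 ≤_) (sym (count-remove (λ u → adj G v u ∧ not ⌊ x ≟ u ⌋) {y}
                                             (cong₂ (λ a b → a ∧ not b) vy (≟-false x≢y))))
                (s≤s z≤n)))

adjacent-leaves⇒n≤2 : ∀ {n} {G : Graph n} {s t} → Connected G → adj G s t ≡ true →
                      deg G s ≡ 1 → deg G t ≡ 1 → n ≤ 2
adjacent-leaves⇒n≤2 {n} {G} {s} {t} connected st s-leaf t-leaf = injective⇒≤ {f = side} side-injective
  where
  OnEdge : Fin n → Set
  OnEdge z = z ≡ s ⊎ z ≡ t
  stay : ∀ {z u} → OnEdge z → adj G z u ≡ true → OnEdge u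
  stay (inj₁ refl) zu = inj₂ (deg≡1-unique G s-leaf zu st)
  stay (inj₂ refl) zu = inj₁ (deg≡1-unique G t-leaf zu (trans (adj-sym G t s) st))
  on-edge : ∀ z → OnEdge z
  on-edge z = Reach-preserves OnEdge stay (connected s z) (inj₁ refl)
  side : Fin n → Fin 2
  side z = if ⌊ z ≟ s ⌋ then zero else suc zero
  side-injective : ∀ {x y} → side x ≡ side y → x ≡ y
  side-injective {x} {y} eq with x ≟ s | y ≟ s | on-edge x | on-edge y
  ... | yes refl | yes refl | _ | _ = refl
  ... | no x≢s | no y≢s | inj₁ x≡s | _ = ⊥-elim (x≢s x≡s)
  ... | no x≢s | no y≢s | _ | inj₁ y≡s = ⊥-elim (y≢s y≡s)
  ... | no _   | no _   | inj₂ refl | inj₂ refl = refl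

leaves⇒∣S∣≤steinerDist : ∀ {n} {G : Graph n} {S d} → Connected G → 3 ≤ n → SteinerDist G S d →
                         2 ≤ ∣ S ∣ → (∀ {v} → v ∈ S → deg G v ≡ 1) → ∣ S ∣ ≤ d
leaves⇒∣S∣≤steinerDist {n} {G} {S} {d} connected 3≤n ((H , edges≡d) , _) 2≤∣S∣ leaf with ∣ S ∣ ≤? d
... | yes ∣S∣≤d = ∣S∣≤d
... | no  ∣S∣≰d
  with s , s′ , s≢s′ , s∈S , s′∈S ← count-two (lookup S) (subst (2 ≤_) (∣p∣≡count S) 2≤∣S∣)
  with t , st ← Reach-first-step (W-conn H s s′ (S⊆W H (lookup⇒[]= s S s∈S)) (S⊆W H (lookup⇒[]= s′ S s′∈S)))
                                 s≢s′ =
  ⊥-elim (≤⇒≯ (adjacent-leaves⇒n≤2 {G = G} connected (F⊆E H s t st)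
                  (leaf (lookup⇒[]= s S s∈S)) (leaf (W⊆S (proj₂ (F-ends H s t st)))))
               3≤n)
  where
  ∣W∣≤∣S∣ : ∣ W H ∣ ≤ ∣ S ∣
  ∣W∣≤∣S∣ = ≤-trans (∣W∣≤1+edges H) (subst (λ e → suc e ≤ ∣ S ∣) (sym edges≡d) (≰⇒> ∣S∣≰d))
  W⊆S : ∀ {x} → x ∈ W H → x ∈ S
  W⊆S {x} x∈W with x ∈? S
  ... | yes x∈S = x∈S
  ... | no  x∉S = ⊥-elim (<⇒≱ (p⊂q⇒∣p∣<∣q∣ (S⊆W H , x , x∈W , x∉S)) ∣W∣≤∣S∣)

∣S∣≤degProd*steinerDist : ∀ {n} {G : Graph n} {S d} → Connected G → 3 ≤ n → SteinerDist G S d →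
                          2 ≤ ∣ S ∣ → ∣ S ∣ ≤ degProd G S * d
∣S∣≤degProd*steinerDist {n} {G} {S} {d} connected 3≤n sd 2≤∣S∣ =
  subst (λ P → ∣ S ∣ ≤ P * d) (sym (degProd≡prodOver G S))
        (by-cases (any? (λ v → v ∈? S ×-dec ¬? (deg G v ℕ.≟ 1))))
  where
  open ≤-Reasoning
  P : ℕ
  P = prodOver S (deg G)
  positive : ∀ v → 1 ≤ deg G v
  positive = connected⇒deg≥1 {G = G} connected (≤-trans (n≤1+n 2) 3≤n)
  by-cases : Dec (∃ λ v → v ∈ S × deg G v ≢ 1) → ∣ S ∣ ≤ P * d
  by-cases (no no-inner) = begin
    ∣ S ∣       ≤⟨ leaves⇒∣S∣≤steinerDist connected 3≤n sd 2≤∣S∣ leaf ⟩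
    d           ≡⟨ *-identityˡ d ⟨
    1 * d       ≤⟨ *-monoˡ-≤ d (subst (_≤ P) (^-zeroˡ ∣ S ∣) (^≤prodOver S positive)) ⟩
    P * d       ∎
    where
    leaf : ∀ {v} → v ∈ S → deg G v ≡ 1
    leaf {v} v∈S with deg G v ℕ.≟ 1
    ... | yes deg≡1 = deg≡1
    ... | no  deg≢1 = ⊥-elim (no-inner (v , v∈S , deg≢1))
  by-cases (yes (v , v∈S , deg≢1)) = begin
    ∣ S ∣       ≤⟨ ∣S∣≤1+steinerDist sd ⟩
    1 + d       ≤⟨ +-monoˡ-≤ d (≤-pred (≤-trans 2≤∣S∣ (∣S∣≤1+steinerDist sd))) ⟩
    d + d       ≡⟨ cong (d +_) (+-identityʳ d) ⟨
    2 * d       ≤⟨ *-monoˡ-≤ d (≤-trans (≤∧≢⇒< (positive v) (deg≢1 ∘ sym)) (∈⇒≤prodOver positive v∈S)) ⟩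
    P * d       ∎

sgut-≤ : ∀ {n k a M} {G : Graph (suc n)} → Connected G → IsSGut G (suc k) a →
         (∀ v → deg G v ≤ M) → suc k * a ≤ n * M ^ k * (n C k) * sum (deg G)
sgut-≤ {n} {k} {a} {M} {G} connected (dist , steiner , refl) deg≤M = begin
  suc k * a
    ≡⟨ sumSized-* L (suc k) (suc k) (λ S → degProd G S * dist S) ⟨
  sumSized L (suc k) (λ S → suc k * (degProd G S * dist S))
    ≤⟨ sumSized-mono L (suc k) each ⟩
  sumSized L (suc k) (λ S → (n * M ^ k) * sumOver S (deg G))
    ≡⟨ sumSized-*-sumOver n k (n * M ^ k) (deg G) ⟩
  n * M ^ k * (n C k) * sum (deg G) ∎
  where
  open ≤-Reasoning
  L : List (Subset (suc n))
  L = allSubsets (suc n)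
  each : ∀ S → ∣ S ∣ ≡ suc k → suc k * (degProd G S * dist S) ≤ n * M ^ k * sumOver S (deg G)
  each S ∣S∣≡ = begin
    suc k * (degProd G S * dist S)           ≡⟨ x∙yz≈z∙xy (suc k) (degProd G S) (dist S) ⟩
    dist S * (suc k * degProd G S)           ≡⟨ cong (λ P → dist S * (suc k * P)) (degProd≡prodOver G S) ⟩
    dist S * (suc k * prodOver S (deg G))    ≤⟨ *-mono-≤ (steinerDist≤n connected (steiner S ∣S∣≡))
                                                  (subst (λ c → c * prodOver S (deg G) ≤ M ^ (c ∸ 1) * sumOver S (deg G)) ∣S∣≡
                                                         (∣S∣*prodOver≤^*sumOver S deg≤M)) ⟩
    n * (M ^ k * sumOver S (deg G))          ≡⟨ *-assoc n (M ^ k) _ ⟨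
    n * M ^ k * sumOver S (deg G)            ∎

sgut-≥ : ∀ {n k a M} {G : Graph (suc n)} → IsSGut G (suc k) a →
         (∀ v → M ≤ deg G v) → k * M ^ k * (n C k) * sum (deg G) ≤ suc k * a
sgut-≥ {n} {k} {a} {M} {G} (dist , steiner , refl) M≤deg = begin
  k * M ^ k * (n C k) * sum (deg G)
    ≡⟨ sumSized-*-sumOver n k (k * M ^ k) (deg G) ⟨
  sumSized L (suc k) (λ S → (k * M ^ k) * sumOver S (deg G))
    ≤⟨ sumSized-mono L (suc k) each ⟩
  sumSized L (suc k) (λ S → suc k * (degProd G S * dist S))
    ≡⟨ sumSized-* L (suc k) (suc k) (λ S → degProd G S * dist S) ⟩
  suc k * a ∎
  where
  open ≤-Reasoning
  L : List (Subset (suc n))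
  L = allSubsets (suc n)
  each : ∀ S → ∣ S ∣ ≡ suc k → k * M ^ k * sumOver S (deg G) ≤ suc k * (degProd G S * dist S)
  each S ∣S∣≡ = begin
    k * M ^ k * sumOver S (deg G)            ≡⟨ *-assoc k (M ^ k) _ ⟩
    k * (M ^ k * sumOver S (deg G))          ≤⟨ *-mono-≤ (≤-pred (subst (_≤ _) ∣S∣≡ (∣S∣≤1+steinerDist (steiner S ∣S∣≡))))
                                                  (subst (λ c → M ^ (c ∸ 1) * sumOver S (deg G) ≤ c * prodOver S (deg G)) ∣S∣≡
                                                         (^*sumOver≤∣S∣*prodOver S M≤deg)) ⟩
    dist S * (suc k * prodOver S (deg G))    ≡⟨ cong (λ P → dist S * (suc k * P)) (degProd≡prodOver G S) ⟨
    dist S * (suc k * degProd G S)           ≡⟨ x∙yz≈z∙xy (suc k) (degProd G S) (dist S) ⟨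
    suc k * (degProd G S * dist S)           ∎

k*nCk≤sgut : ∀ {n k a} {G : Graph n} → Connected G → 3 ≤ n → 2 ≤ k → IsSGut G k a → k * (n C k) ≤ a
k*nCk≤sgut {n} {k} {a} {G} connected 3≤n 2≤k (dist , steiner , refl) = begin
  k * (n C k)                                        ≡⟨ sumSized-const n k k ⟨
  sumSized (allSubsets n) k (λ _ → k)                ≤⟨ sumSized-mono (allSubsets n) k each ⟩
  sumSized (allSubsets n) k (λ S → degProd G S * dist S) ∎
  where
  open ≤-Reasoning
  each : ∀ S → ∣ S ∣ ≡ k → k ≤ degProd G S * dist S
  each S refl = ∣S∣≤degProd*steinerDist connected 3≤n (steiner S refl) 2≤k

-- Nordhaus–Gaddum bounds

[1+n]∸x∸1≡n∸x : ∀ n x → suc n ∸ x ∸ 1 ≡ n ∸ x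
[1+n]∸x∸1≡n∸x n x = trans (∸-+-assoc (suc n) x 1) (cong (suc n ∸_) (+-comm x 1))

x^2≡x*x : ∀ x → x ^ 2 ≡ x * x
x^2≡x*x x = cong (x *_) (*-identityʳ x)

n^2∸n≡n*[n∸1] : ∀ n → n ^ 2 ∸ n ≡ n * (n ∸ 1)
n^2∸n≡n*[n∸1] n = begin
  n ^ 2 ∸ n          ≡⟨ cong₂ _∸_ (x^2≡x*x n) (sym (*-identityʳ n)) ⟩
  n * n ∸ n * 1      ≡⟨ *-distribˡ-∸ n n 1 ⟨
  n * (n ∸ 1)        ∎
  where open ≡-Reasoning

-- The graph has suc n vertices and the subsets have suc k elements, so the n − 1 and k − 1 of
-- the paper appear as n and k.
module NordhausGaddum {n k m Δ δ a b : ℕ} {G : Graph (suc n)}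
  (connected : Connected G) (connectedᶜ : Connected (complement G)) (size≡m : size G ≡ m)
  (deg≤Δ : ∀ v → deg G v ≤ Δ) (δ≤deg : ∀ v → δ ≤ deg G v) (δ≤Δ : δ ≤ Δ) (1≤k : 1 ≤ k)
  (sgut : IsSGut G (suc k) a) (sgutᶜ : IsSGut (complement G) (suc k) b) where

  open ≤-Reasoning

  Gᶜ : Graph (suc n)
  Gᶜ = complement G

  Σdeg : sum (deg G) ≡ 2 * m
  Σdeg = trans (∑deg≡2*size G) (cong (2 *_) size≡m)

  Σdeg+Σdegᶜ : sum (deg G) + sum (deg Gᶜ) ≡ suc n * n
  Σdeg+Σdegᶜ = ∑deg+∑degᶜ G

  Σdegᶜ : sum (deg Gᶜ) ≡ suc n * n ∸ 2 * m
  Σdegᶜ = trans (sym (m+n∸m≡n (sum (deg G)) _)) (cong₂ _∸_ Σdeg+Σdegᶜ Σdeg)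

  Σdegᶜ′ : sum (deg Gᶜ) ≡ suc n ^ 2 ∸ suc n ∸ 2 * m
  Σdegᶜ′ = trans Σdegᶜ (cong (_∸ 2 * m) (sym (n^2∸n≡n*[n∸1] (suc n))))

  degᶜ≡ : ∀ v → deg Gᶜ v ≡ n ∸ deg G v
  degᶜ≡ v = trans (sym (m+n∸n≡m _ (deg G v))) (cong (_∸ deg G v) (suc-injective (deg-complement G v)))

  degᶜ≤ : ∀ v → deg Gᶜ v ≤ suc n ∸ δ ∸ 1
  degᶜ≤ v = subst₂ _≤_ (sym (degᶜ≡ v)) (sym ([1+n]∸x∸1≡n∸x n δ)) (∸-monoʳ-≤ n (δ≤deg v))

  degᶜ≥ : ∀ v → suc n ∸ Δ ∸ 1 ≤ deg Gᶜ v
  degᶜ≥ v = subst₂ _≤_ (sym ([1+n]∸x∸1≡n∸x n Δ)) (sym (degᶜ≡ v)) (∸-monoʳ-≤ n (deg≤Δ v))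

  3≤order : Δ + 3 ≤ suc n → 3 ≤ suc n
  3≤order = ≤-trans (m≤n+m 3 Δ)

  3≤order′ : 1 ≤ δ → Δ + 2 ≡ suc n → 3 ≤ suc n
  3≤order′ 1≤δ Δ+2≡ = subst (3 ≤_) Δ+2≡ (+-monoˡ-≤ 2 (≤-trans 1≤δ δ≤Δ))

  ka≤ : ∀ {M} → (∀ v → deg G v ≤ M) → suc k * a ≤ n * M ^ k * (n C k) * sum (deg G)
  ka≤ = sgut-≤ {G = G} connected sgut

  kb≤ : ∀ {M} → (∀ v → deg Gᶜ v ≤ M) → suc k * b ≤ n * M ^ k * (n C k) * sum (deg Gᶜ)
  kb≤ = sgut-≤ {G = Gᶜ} connectedᶜ sgutᶜ

  ka≥ : ∀ {M} → (∀ v → M ≤ deg G v) → k * M ^ k * (n C k) * sum (deg G) ≤ suc k * a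
  ka≥ = sgut-≥ {G = G} sgut

  kb≥ : ∀ {M} → (∀ v → M ≤ deg Gᶜ v) → k * M ^ k * (n C k) * sum (deg Gᶜ) ≤ suc k * b
  kb≥ = sgut-≥ {G = Gᶜ} sgutᶜ

  binomial≤a : 3 ≤ suc n → suc k * (suc n C suc k) ≤ a
  binomial≤a 3≤n = k*nCk≤sgut {G = G} connected 3≤n (s≤s 1≤k) sgut

  binomial≤b : 3 ≤ suc n → suc k * (suc n C suc k) ≤ b
  binomial≤b 3≤n = k*nCk≤sgut {G = Gᶜ} connectedᶜ 3≤n (s≤s 1≤k) sgutᶜ

  sum-≤ : a + b ≤ n ^ 2 * (suc n C suc k) * (Δ ⊔ (suc n ∸ δ ∸ 1)) ^ k
  sum-≤ = *-cancelˡ-≤ (suc k) (begin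
    suc k * (a + b)                            ≡⟨ *-distribˡ-+ (suc k) a b ⟩
    suc k * a + suc k * b                      ≤⟨ +-mono-≤ (ka≤ deg≤s) (kb≤ degᶜ≤s) ⟩
    X * sum (deg G) + X * sum (deg Gᶜ)         ≡⟨ *-distribˡ-+ X (sum (deg G)) _ ⟨
    X * (sum (deg G) + sum (deg Gᶜ))           ≡⟨ cong (X *_) Σdeg+Σdegᶜ ⟩
    X * (suc n * n)                            ≡⟨ rearrange n (s ^ k) (n C k) (suc n) ⟩
    suc n * (n C k) * (n * n * s ^ k)          ≡⟨ cong (λ q → suc n * (n C k) * (q * s ^ k)) (x^2≡x*x n) ⟨
    suc n * (n C k) * (n ^ 2 * s ^ k)          ≡⟨ cong (_* (n ^ 2 * s ^ k)) ([1+n]*nCk≡[1+k]*[1+n]C[1+k] n k) ⟩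
    suc k * (suc n C suc k) * (n ^ 2 * s ^ k)  ≡⟨ rearrange′ (suc k) (suc n C suc k) (n ^ 2) (s ^ k) ⟩
    suc k * (n ^ 2 * (suc n C suc k) * s ^ k)  ∎)
    where
    s X : ℕ
    s = Δ ⊔ (suc n ∸ δ ∸ 1)
    X = n * s ^ k * (n C k)
    deg≤s : ∀ v → deg G v ≤ s
    deg≤s v = ≤-trans (deg≤Δ v) (m≤m⊔n Δ _)
    degᶜ≤s : ∀ v → deg Gᶜ v ≤ s
    degᶜ≤s v = ≤-trans (degᶜ≤ v) (m≤n⊔m Δ _)
    rearrange : ∀ x p c y → x * p * c * (y * x) ≡ y * c * (x * x * p)
    rearrange = solve-∀
    rearrange′ : ∀ x c q p → x * c * (q * p) ≡ x * (q * c * p)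
    rearrange′ = solve-∀

  product-≤ : suc k ^ 2 * (a * b) ≤
              2 * m * (suc n ^ 2 ∸ suc n ∸ 2 * m) * n ^ 2 * (n C k) ^ 2 * (Δ ^ k * (suc n ∸ δ ∸ 1) ^ k)
  product-≤ = begin
    suc k ^ 2 * (a * b)                              ≡⟨ cong (_* (a * b)) (x^2≡x*x (suc k)) ⟩
    suc k * suc k * (a * b)                          ≡⟨ *-interchange (suc k) (suc k) a b ⟩
    suc k * a * (suc k * b)                          ≤⟨ *-mono-≤ (ka≤ deg≤Δ) (kb≤ degᶜ≤) ⟩
    n * Δ ^ k * c * sum (deg G) * (n * e ^ k * c * sum (deg Gᶜ))
      ≡⟨ cong₂ (λ x y → n * Δ ^ k * c * x * (n * e ^ k * c * y)) Σdeg Σdegᶜ′ ⟩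
    n * Δ ^ k * c * (2 * m) * (n * e ^ k * c * t)    ≡⟨ regroup n (Δ ^ k) c m (e ^ k) t ⟩
    2 * m * t * (n * n) * (c * c) * (Δ ^ k * e ^ k)
      ≡⟨ cong₂ (λ x y → 2 * m * t * x * y * (Δ ^ k * e ^ k)) (x^2≡x*x n) (x^2≡x*x c) ⟨
    2 * m * t * n ^ 2 * c ^ 2 * (Δ ^ k * e ^ k)      ∎
    where
    c e t : ℕ
    c = n C k
    e = suc n ∸ δ ∸ 1
    t = suc n ^ 2 ∸ suc n ∸ 2 * m
    regroup : ∀ x p c m q t → x * p * c * (2 * m) * (x * q * c * t) ≡ 2 * m * t * (x * x) * (c * c) * (p * q)
    regroup = solve-∀

  sum-≥ : n * k * (suc n C suc k) * (δ ⊓ (suc n ∸ Δ ∸ 1)) ^ k ≤ a + b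
  sum-≥ = *-cancelˡ-≤ (suc k) (begin
    suc k * (n * k * (suc n C suc k) * s ^ k)  ≡⟨ rearrange (suc k) n k (suc n C suc k) (s ^ k) ⟩
    suc k * (suc n C suc k) * (k * s ^ k * n)  ≡⟨ cong (_* (k * s ^ k * n)) ([1+n]*nCk≡[1+k]*[1+n]C[1+k] n k) ⟨
    suc n * (n C k) * (k * s ^ k * n)          ≡⟨ rearrange′ (suc n) (n C k) k (s ^ k) n ⟩
    Y * (suc n * n)                            ≡⟨ cong (Y *_) Σdeg+Σdegᶜ ⟨
    Y * (sum (deg G) + sum (deg Gᶜ))           ≡⟨ *-distribˡ-+ Y (sum (deg G)) _ ⟩
    Y * sum (deg G) + Y * sum (deg Gᶜ)         ≤⟨ +-mono-≤ (ka≥ s≤deg) (kb≥ s≤degᶜ) ⟩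
    suc k * a + suc k * b                      ≡⟨ *-distribˡ-+ (suc k) a b ⟨
    suc k * (a + b)                            ∎)
    where
    s Y : ℕ
    s = δ ⊓ (suc n ∸ Δ ∸ 1)
    Y = k * s ^ k * (n C k)
    s≤deg : ∀ v → s ≤ deg G v
    s≤deg v = ≤-trans (m⊓n≤m δ _) (δ≤deg v)
    s≤degᶜ : ∀ v → s ≤ deg Gᶜ v
    s≤degᶜ v = ≤-trans (m⊓n≤n δ _) (degᶜ≥ v)
    rearrange : ∀ x n k c p → x * (n * k * c * p) ≡ x * c * (k * p * n)
    rearrange = solve-∀
    rearrange′ : ∀ y c k p n → y * c * (k * p * n) ≡ k * p * c * (y * n)
    rearrange′ = solve-∀

  sum-≥-binomialᶜ : 3 ≤ suc n →
                    2 * m * k * (n C k) * δ ^ k + suc k * (suc k * (suc n C suc k)) ≤ suc k * (a + b)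
  sum-≥-binomialᶜ 3≤n = begin
    2 * m * k * (n C k) * δ ^ k + K            ≡⟨ cong (_+ K) (rearrange m k (n C k) (δ ^ k)) ⟩
    k * δ ^ k * (n C k) * (2 * m) + K          ≡⟨ cong (λ x → k * δ ^ k * (n C k) * x + K) Σdeg ⟨
    k * δ ^ k * (n C k) * sum (deg G) + K      ≤⟨ +-mono-≤ (ka≥ δ≤deg) (*-monoʳ-≤ (suc k) (binomial≤b 3≤n)) ⟩
    suc k * a + suc k * b                      ≡⟨ *-distribˡ-+ (suc k) a b ⟨
    suc k * (a + b)                            ∎
    where
    K : ℕ
    K = suc k * (suc k * (suc n C suc k))
    rearrange : ∀ m k c p → 2 * m * k * c * p ≡ k * p * c * (2 * m)
    rearrange = solve-∀

  sum-≥-binomial : 3 ≤ suc n →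
                   suc k * (suc k * (suc n C suc k)) + (suc n * n ∸ 2 * m) * k * (n C k) * (suc n ∸ Δ ∸ 1) ^ k
                   ≤ suc k * (a + b)
  sum-≥-binomial 3≤n = begin
    K + t * k * (n C k) * e ^ k                ≡⟨ cong (K +_) (rearrange t k (n C k) (e ^ k)) ⟩
    K + k * e ^ k * (n C k) * t                ≡⟨ cong (λ x → K + k * e ^ k * (n C k) * x) Σdegᶜ ⟨
    K + k * e ^ k * (n C k) * sum (deg Gᶜ)     ≤⟨ +-mono-≤ (*-monoʳ-≤ (suc k) (binomial≤a 3≤n)) (kb≥ degᶜ≥) ⟩
    suc k * a + suc k * b                      ≡⟨ *-distribˡ-+ (suc k) a b ⟨
    suc k * (a + b)                            ∎
    where
    K e t : ℕ
    K = suc k * (suc k * (suc n C suc k))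
    e = suc n ∸ Δ ∸ 1
    t = suc n * n ∸ 2 * m
    rearrange : ∀ t k c p → t * k * c * p ≡ k * p * c * t
    rearrange = solve-∀

  sum-≥-binomial² : 3 ≤ suc n → 2 * suc k * (suc n C suc k) ≤ a + b
  sum-≥-binomial² 3≤n =
    subst (_≤ a + b) (double (suc k) (suc n C suc k)) (+-mono-≤ (binomial≤a 3≤n) (binomial≤b 3≤n))
    where
    double : ∀ x c → x * c + x * c ≡ 2 * x * c
    double = solve-∀

  product-≥ : 2 * m * (suc n ^ 2 ∸ suc n ∸ 2 * m) * k ^ 2 * (n C k) ^ 2 * (δ ^ k * (suc n ∸ Δ ∸ 1) ^ k)
              ≤ suc k ^ 2 * (a * b)
  product-≥ = begin
    2 * m * t * k ^ 2 * c ^ 2 * (δ ^ k * e ^ k)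
      ≡⟨ cong₂ (λ x y → 2 * m * t * x * y * (δ ^ k * e ^ k)) (x^2≡x*x k) (x^2≡x*x c) ⟩
    2 * m * t * (k * k) * (c * c) * (δ ^ k * e ^ k)  ≡⟨ regroup k (δ ^ k) c m (e ^ k) t ⟩
    k * δ ^ k * c * (2 * m) * (k * e ^ k * c * t)
      ≡⟨ cong₂ (λ x y → k * δ ^ k * c * x * (k * e ^ k * c * y)) Σdeg Σdegᶜ′ ⟨
    k * δ ^ k * c * sum (deg G) * (k * e ^ k * c * sum (deg Gᶜ))
                                                     ≤⟨ *-mono-≤ (ka≥ δ≤deg) (kb≥ degᶜ≥) ⟩
    suc k * a * (suc k * b)                          ≡⟨ *-interchange (suc k) (suc k) a b ⟨
    suc k * suc k * (a * b)                          ≡⟨ cong (_* (a * b)) (x^2≡x*x (suc k)) ⟨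
    suc k ^ 2 * (a * b)                              ∎
    where
    c e t : ℕ
    c = n C k
    e = suc n ∸ Δ ∸ 1
    t = suc n ^ 2 ∸ suc n ∸ 2 * m
    regroup : ∀ x p c m q t → 2 * m * t * (x * x) * (c * c) * (p * q) ≡ x * p * c * (2 * m) * (x * q * c * t)
    regroup = solve-∀

  product-≥-binomialᶜ : 3 ≤ suc n → 2 * m * k * (suc n C suc k) * (n C k) * δ ^ k ≤ a * b
  product-≥-binomialᶜ 3≤n = *-cancelˡ-≤ (suc k) (begin
    suc k * (2 * m * k * B * (n C k) * δ ^ k)            ≡⟨ rearrange (suc k) m k B (n C k) (δ ^ k) ⟩
    k * δ ^ k * (n C k) * (2 * m) * (suc k * B)          ≡⟨ cong (λ x → k * δ ^ k * (n C k) * x * (suc k * B)) Σdeg ⟨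
    k * δ ^ k * (n C k) * sum (deg G) * (suc k * B)      ≤⟨ *-mono-≤ (ka≥ δ≤deg) (binomial≤b 3≤n) ⟩
    suc k * a * b                                        ≡⟨ *-assoc (suc k) a b ⟩
    suc k * (a * b)                                      ∎)
    where
    B : ℕ
    B = suc n C suc k
    rearrange : ∀ x m k c′ c p → x * (2 * m * k * c′ * c * p) ≡ k * p * c * (2 * m) * (x * c′)
    rearrange = solve-∀

  product-≥-binomial : 3 ≤ suc n →
                       (suc n * n ∸ 2 * m) * k * (suc n C suc k) * (n C k) * (suc n ∸ Δ ∸ 1) ^ k ≤ a * b
  product-≥-binomial 3≤n = *-cancelˡ-≤ (suc k) (begin
    suc k * (t * k * B * (n C k) * e ^ k)                ≡⟨ rearrange (suc k) t k B (n C k) (e ^ k) ⟩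
    suc k * B * (k * e ^ k * (n C k) * t)                ≡⟨ cong (λ x → suc k * B * (k * e ^ k * (n C k) * x)) Σdegᶜ ⟨
    suc k * B * (k * e ^ k * (n C k) * sum (deg Gᶜ))     ≤⟨ *-mono-≤ (binomial≤a 3≤n) (kb≥ degᶜ≥) ⟩
    a * (suc k * b)                                      ≡⟨ x∙yz≈y∙xz a (suc k) b ⟩
    suc k * (a * b)                                      ∎)
    where
    B e t : ℕ
    B = suc n C suc k
    e = suc n ∸ Δ ∸ 1
    t = suc n * n ∸ 2 * m
    rearrange : ∀ x t k c′ c p → x * (t * k * c′ * c * p) ≡ x * c′ * (k * p * c * t)
    rearrange = solve-∀

  product-≥-binomial² : 3 ≤ suc n → suc k ^ 2 * (suc n C suc k) ^ 2 ≤ a * b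
  product-≥-binomial² 3≤n = begin
    suc k ^ 2 * B ^ 2        ≡⟨ cong₂ _*_ (x^2≡x*x (suc k)) (x^2≡x*x B) ⟩
    suc k * suc k * (B * B)  ≡⟨ *-interchange (suc k) (suc k) B B ⟩
    suc k * B * (suc k * B)  ≤⟨ *-mono-≤ (binomial≤a 3≤n) (binomial≤b 3≤n) ⟩
    a * b                    ∎
    where
    B : ℕ
    B = suc n C suc k

-- Sharpness: the 5-cycle

iterate : ∀ {A : Set} → (A → A) → ℕ → A → A
iterate f zero    x = x
iterate f (suc j) x = iterate f j (f x)

Reach-iterate : ∀ {n} {E : Fin n → Fin n → Bool} (f : Fin n → Fin n) →
                (∀ u → E u (f u) ≡ true) → ∀ j u → Reach E u (iterate f j u)
Reach-iterate f E-f zero    u = here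
Reach-iterate f E-f (suc j) u = step (E-f u) (Reach-iterate f E-f j (f u))

connected-by-orbits : ∀ {n} (G : Graph n) (f : Fin n → Fin n) {r} → (∀ u → adj G u (f u) ≡ true) →
                      (∀ u → ∃ λ (j : Fin n) → iterate f (toℕ j) u ≡ r) → Connected G
connected-by-orbits G f {r} adj-f orbit u v = Reach-++ (to-r u) (Reach-reverse (adj-sym G) (to-r v))
  where
  to-r : ∀ u → Reach (adj G) u r
  to-r u with j , eq ← orbit u = subst (Reach (adj G) u) eq (Reach-iterate f adj-f (toℕ j) u)

next : Fin 5 → Fin 5
next v = fromℕ< (m%n<n (suc (toℕ v)) 5)

C₅ : Graph 5
C₅ = record
  { adj        = λ u v → ⌊ next u ≟ v ⌋ ∨ ⌊ next v ≟ u ⌋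
  ; adj-sym    = λ u v → ∨-comm ⌊ next u ≟ v ⌋ ⌊ next v ≟ u ⌋
  ; adj-irrefl = from-yes (all? λ v → ⌊ next v ≟ v ⌋ ∨ ⌊ next v ≟ v ⌋ Bool.≟ false)
  }

C₅-connected : Connected C₅
C₅-connected = connected-by-orbits C₅ next {zero}
  (from-yes (all? λ u → adj C₅ u (next u) Bool.≟ true))
  (from-yes (all? λ u → any? λ (j : Fin 5) → iterate next (toℕ j) u ≟ zero))

C₅ᶜ-connected : Connected (complement C₅)
C₅ᶜ-connected = connected-by-orbits (complement C₅) (next ∘ next) {zero}
  (from-yes (all? λ u → adj (complement C₅) u (next (next u)) Bool.≟ true))
  (from-yes (all? λ u → any? λ (j : Fin 5) → iterate (next ∘ next) (toℕ j) u ≟ zero))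

C₅-2-regular : ∀ v → deg C₅ v ≡ 2
C₅-2-regular = from-yes (all? λ v → deg C₅ v ℕ.≟ 2)

C₅-hyp : Hyp 5 C₅ 5 5 2 2
C₅-hyp = C₅-connected , C₅ᶜ-connected , refl
       , ((≤-reflexive ∘ C₅-2-regular) , zero , refl)
       , ((≤-reflexive ∘ sym ∘ C₅-2-regular) , zero , refl)
       , s≤s (s≤s z≤n) , ≤-refl

C₅-sgut : IsSGut C₅ 5 128
C₅-sgut = (λ _ → 4) , (λ S → steinerDist-spanning {G = C₅} C₅-connected) , refl

C₅ᶜ-sgut : IsSGut (complement C₅) 5 128
C₅ᶜ-sgut = (λ _ → 4) , (λ S → steinerDist-spanning {G = complement C₅} C₅ᶜ-connected) , refl

theorem3p1 :
  (∀ (n : ℕ) (G : Graph n) (k m Δ δ a b : ℕ) →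
    Hyp n G k m Δ δ → IsSGut G k a → IsSGut (complement G) k b →
    let s₁ = Δ ⊔ (n ∸ δ ∸ 1)
        t₁ = δ ⊓ (n ∸ Δ ∸ 1)
    in
    (a + b ≤ (n ∸ 1) ^ 2 * (n C k) * s₁ ^ (k ∸ 1)) ×
    (k ^ 2 * (a * b) ≤ 2 * m * (n ^ 2 ∸ n ∸ 2 * m) * (n ∸ 1) ^ 2 * ((n ∸ 1) C (k ∸ 1)) ^ 2
                        * (Δ ^ (k ∸ 1) * (n ∸ δ ∸ 1) ^ (k ∸ 1))) ×
    (2 ≤ δ → Δ + 3 ≤ n →
      (n ∸ 1) * (k ∸ 1) * (n C k) * t₁ ^ (k ∸ 1) ≤ a + b) ×
    (2 ≤ δ → Δ + 2 ≡ n →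
      2 * m * (k ∸ 1) * ((n ∸ 1) C (k ∸ 1)) * δ ^ (k ∸ 1) + k * (k * (n C k)) ≤ k * (a + b)) ×
    (δ ≡ 1 → Δ + 3 ≤ n →
      k * (k * (n C k)) + (n * (n ∸ 1) ∸ 2 * m) * (k ∸ 1) * ((n ∸ 1) C (k ∸ 1)) * (n ∸ Δ ∸ 1) ^ (k ∸ 1)
        ≤ k * (a + b)) ×
    (δ ≡ 1 → Δ + 2 ≡ n →
      2 * k * (n C k) ≤ a + b) ×
    (2 ≤ δ → Δ + 3 ≤ n →
      2 * m * (n ^ 2 ∸ n ∸ 2 * m) * (k ∸ 1) ^ 2 * ((n ∸ 1) C (k ∸ 1)) ^ 2
        * (δ ^ (k ∸ 1) * (n ∸ Δ ∸ 1) ^ (k ∸ 1)) ≤ k ^ 2 * (a * b)) ×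
    (2 ≤ δ → Δ + 2 ≡ n →
      2 * m * (k ∸ 1) * (n C k) * ((n ∸ 1) C (k ∸ 1)) * δ ^ (k ∸ 1) ≤ a * b) ×
    (δ ≡ 1 → Δ + 3 ≤ n →
      (n * (n ∸ 1) ∸ 2 * m) * (k ∸ 1) * (n C k) * ((n ∸ 1) C (k ∸ 1)) * (n ∸ Δ ∸ 1) ^ (k ∸ 1) ≤ a * b) ×
    (δ ≡ 1 → Δ + 2 ≡ n →
      k ^ 2 * (n C k) ^ 2 ≤ a * b))
  ×
  (Σ[ n ∈ ℕ ] Σ[ G ∈ Graph n ] Σ[ k ∈ ℕ ] Σ[ m ∈ ℕ ] Σ[ Δ ∈ ℕ ] Σ[ δ ∈ ℕ ] Σ[ a ∈ ℕ ] Σ[ b ∈ ℕ ]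
    (Hyp n G k m Δ δ × IsSGut G k a × IsSGut (complement G) k b ×
     a + b ≡ (n ∸ 1) ^ 2 * (n C k) * (Δ ⊔ (n ∸ δ ∸ 1)) ^ (k ∸ 1)))
  ×
  (Σ[ n ∈ ℕ ] Σ[ G ∈ Graph n ] Σ[ k ∈ ℕ ] Σ[ m ∈ ℕ ] Σ[ Δ ∈ ℕ ] Σ[ δ ∈ ℕ ] Σ[ a ∈ ℕ ] Σ[ b ∈ ℕ ]
    (Hyp n G k m Δ δ × IsSGut G k a × IsSGut (complement G) k b ×
     k ^ 2 * (a * b) ≡ 2 * m * (n ^ 2 ∸ n ∸ 2 * m) * (n ∸ 1) ^ 2 * ((n ∸ 1) C (k ∸ 1)) ^ 2
                        * (Δ ^ (k ∸ 1) * (n ∸ δ ∸ 1) ^ (k ∸ 1))))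

-- The case hypotheses of the lower bounds only serve to guarantee n ≥ 3.
theorem3p1 .proj₁ n G zero m Δ δ a b (_ , _ , _ , _ , _ , () , _)
theorem3p1 .proj₁ n G (suc zero) m Δ δ a b (_ , _ , _ , _ , _ , s≤s () , _)
theorem3p1 .proj₁ zero G (suc (suc k)) m Δ δ a b (_ , _ , _ , _ , _ , _ , ())
theorem3p1 .proj₁ (suc n) G (suc (suc k)) m Δ δ a b
  (connected , connectedᶜ , size≡m , (deg≤Δ , _) , (δ≤deg , v , deg≡δ) , _) sgut sgutᶜ =
  sum-≤ , product-≤ ,
  (λ _ _ → sum-≥) ,
  (λ 2≤δ Δ+2≡n → sum-≥-binomialᶜ (3≤order′ (≤-trans (n≤1+n 1) 2≤δ) Δ+2≡n)) ,
  (λ _ Δ+3≤n → sum-≥-binomial (3≤order Δ+3≤n)) ,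
  (λ δ≡1 Δ+2≡n → sum-≥-binomial² (3≤order′ (≤-reflexive (sym δ≡1)) Δ+2≡n)) ,
  (λ _ _ → product-≥) ,
  (λ 2≤δ Δ+2≡n → product-≥-binomialᶜ (3≤order′ (≤-trans (n≤1+n 1) 2≤δ) Δ+2≡n)) ,
  (λ _ Δ+3≤n → product-≥-binomial (3≤order Δ+3≤n)) ,
  (λ δ≡1 Δ+2≡n → product-≥-binomial² (3≤order′ (≤-reflexive (sym δ≡1)) Δ+2≡n))
  where
  open NordhausGaddum connected connectedᶜ size≡m deg≤Δ δ≤deg (subst (_≤ Δ) deg≡δ (deg≤Δ v)) (s≤s z≤n) sgut sgutᶜ
theorem3p1 .proj₂ .proj₁ = 5 , C₅ , 5 , 5 , 2 , 2 , 128 , 128 , C₅-hyp , C₅-sgut , C₅ᶜ-sgut , refl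
theorem3p1 .proj₂ .proj₂ = 5 , C₅ , 5 , 5 , 2 , 2 , 128 , 128 , C₅-hyp , C₅-sgut , C₅ᶜ-sgut , refl
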